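{- Let $\widehat{\mathcal M}$ be a realizable rank-$n$ oriented matroid on $[2n+1]$ whose restriction to $[2n]$ is a P-matroid and which is nondegenerate. Then the POMCP-orientation of the $n$-cube induced by $\widehat{\mathcal M}$ is a PLCP-orientation.
   Context: Oriented matroids (chirotope form): a chirotope of rank $r$ on a finite set $E$ is a map $\chi:E^r\to\{+,-,0\}$ that is not identically zero, is alternating, and satisfies: for all $i_1,\dots,i_r,j_1,\dots,j_r\in E$, if $\chi(j_s,i_2,\dots,i_r)\chi(j_1,\dots,j_{s-1},i_1,j_{s+1},\dots,j_r)\ge 0$ for all $s\in[r]$ then $\chi(i_1,\dots,i_r)\chi(j_1,\dots,j_r)\ge0$. An oriented matroid is $(E,\{\chi,-\chi\})$. It is realizable (with $E=[m]$) if there is $V=(v_1,\dots,v_m)\in\mathbb{R}^{r\times m}$ with $\chi(i_1,\dots,i_r)=\mathrm{sgn}\det(v_{i_1},\dots,v_{i_r})$ for all $i_1,\dots,i_r$. Restriction to $F\subseteq E$ is $(F,\{\chi|_F,-\chi|_F\})$. On $[2n]$ write $\bar i=i+n$, $\overline{i+n}=i$ for $i\in[n]$. A P-matroid is a rank-$n$ oriented matroid on $[2n]$ with chirotope $\chi$ such that $\chi(b_1,\dots,b_{i-1},i,b_{i+1},\dots,b_n)=-\chi(b_1,\dots,b_{i-1},\bar i,b_{i+1},\dots,b_n)\neq0$ for all $(b_1,\dots,b_n)\in\{1,\bar1\}\times\dots\times\{n,\bar n\}$, $i\in[n]$. For a rank-$n$ oriented matroid $\widehat{\mathcal M}=([2n+1],\{\hat\chi,-\hat\chi\})$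 whose restriction to $[2n]$ is a P-matroid, nondegeneracy means $\hat\chi(b_1,\dots,b_{i-1},2n+1,b_{i+1},\dots,b_n)\ne0$ for all such $(b_1,\dots,b_n)$ and $i$. The $n$-cube has vertices the subsets of $[n]$, with $B,C$ adjacent iff $|B\oplus C|=1$. For $B\subseteq[n]$ let $b_j=j+n$ if $j\in B$, $b_j=j$ otherwise; the induced (POMCP-)orientation orients $\{B,B\oplus\{i\}\}$ from $B$ to $B\oplus\{i\}$ iff $\hat\chi(b_1,\dots,b_n)\hat\chi(b_1,\dots,b_{i-1},2n+1,b_{i+1},\dots,b_n)=-$. A P-matrix is a real square matrix with all principal minors positive. For $M\in\mathbb{R}^{n\times n}$ and $B\subseteq[n]$, $A_B$ is the $n\times n$ matrix whose $i$th column is the $i$th column of $-M$ if $i\in B$ and of $I_n$ otherwise; $A_B[i,q]$ is $A_B$ with $i$th column replaced by $q$. For a P-matrix $M$ and $q\in\mathbb{R}^n$ with $\det(A_B[i,q])\ne0$ for all $B,i$, the PLCP-orientation orients $\{B,B\oplus\{i\}\}$ from $B$ to $B\oplus\{i\}$ iff $\det(A_B)\det(A_B[i,q])<0$. A PLCP-orientation is an orientation of the $n$-cube arising this way. -}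

module Defs where

open import Level using (0ℓ)
open import Data.Nat using (ℕ; zero; suc; _+_)
open import Data.Fin using (Fin; zero; suc; punchIn; _↑ˡ_; _↑ʳ_; inject₁; fromℕ; _≟_) renaming (_<_ to _<ᶠ_)
open import Data.Bool using (Bool; true; false; if_then_else_)
open import Data.Product using (Σ; ∃; _×_; _,_)
open import Data.Empty using (⊥)
open import Relation.Nullary using (¬_; yes; no)
open import Relation.Binary.PropositionalEquality using (_≡_; _≢_)
open import Relation.Binary.Structures using (IsStrictTotalOrder)
open import Relation.Binary.Definitions using (tri<; tri≈; tri>)
open import Algebra.Structures using (IsCommutativeRing)
open import Function using (_⇔_)

data Sign : Set where
  plus minus zer : Sign

negS : Sign → Sign
negS plus  = minus
negS minus = plus
negS zer   = zer

_·S_ : Sign → Sign → Sign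
zer   ·S _     = zer
_     ·S zer   = zer
plus  ·S s     = s
minus ·S s     = negS s

NonNegS : Sign → Set
NonNegS s = s ≢ minus

-- The real numbers, axiomatised as a (Dedekind-)complete ordered field.
-- Any two models are isomorphic, so quantifying over all models is
-- the same as speaking about ℝ.

record RealField : Set₁ where
  infixl 6 _+ᴿ_
  infixl 7 _*ᴿ_
  infix  4 _<ᴿ_
  field
    Carrier : Set
    _+ᴿ_ _*ᴿ_ : Carrier → Carrier → Carrier
    -ᴿ_ : Carrier → Carrier
    0ᴿ 1ᴿ : Carrier
    _<ᴿ_ : Carrier → Carrier → Set
    isCommutativeRing : IsCommutativeRing _≡_ _+ᴿ_ _*ᴿ_ -ᴿ_ 0ᴿ 1ᴿ
    isStrictTotalOrder : IsStrictTotalOrder _≡_ _<ᴿ_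
    0≢1 : 0ᴿ ≢ 1ᴿ
    inverse : ∀ x → x ≢ 0ᴿ → ∃ λ y → x *ᴿ y ≡ 1ᴿ
    +-mono-< : ∀ {x y} z → x <ᴿ y → x +ᴿ z <ᴿ y +ᴿ z
    *-pos : ∀ {x y} → 0ᴿ <ᴿ x → 0ᴿ <ᴿ y → 0ᴿ <ᴿ x *ᴿ y
    -- least-upper-bound property (x ≤ y written as ¬ (y < x))
    complete : (P : Carrier → Set) → ∃ P → (∃ λ u → ∀ x → P x → ¬ (u <ᴿ x)) →
               ∃ λ s → (∀ x → P x → ¬ (s <ᴿ x)) × (∀ u → (∀ x → P x → ¬ (u <ᴿ x)) → ¬ (u <ᴿ s))

module _ (R : RealField) where
  open RealField R

  sgn : Carrier → Sign
  sgn x with IsStrictTotalOrder.compare isStrictTotalOrder 0ᴿ x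
  ... | tri< _ _ _ = plus
  ... | tri≈ _ _ _ = zer
  ... | tri> _ _ _ = minus

  sumFin : ∀ {n} → (Fin n → Carrier) → Carrier
  sumFin {zero}  f = 0ᴿ
  sumFin {suc n} f = f zero +ᴿ sumFin (λ j → f (suc j))

  altSign : ∀ {n} → Fin n → Carrier
  altSign zero    = 1ᴿ
  altSign (suc j) = -ᴿ altSign j

  -- determinant of an n×n matrix (entry A a b = row a, column b),
  -- by cofactor (Laplace) expansion along the first row
  det : ∀ {n} → (Fin n → Fin n → Carrier) → Carrier
  det {zero}  A = 1ᴿ
  det {suc n} A = sumFin λ j → altSign j *ᴿ A zero j *ᴿ det (λ a b → A (suc a) (punchIn j b))

-- Chirotopes and oriented matroids (represented by a chirotope χ,
-- the oriented matroid being {χ, -χ}).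

_[_≔_] : ∀ {r} {E : Set} → (Fin r → E) → Fin r → E → (Fin r → E)
(t [ p ≔ e ]) k with k ≟ p
... | yes _ = e
... | no  _ = t k

swapT : ∀ {r} {E : Set} → (Fin r → E) → Fin r → Fin r → (Fin r → E)
swapT t p q = (t [ p ≔ t q ]) [ q ≔ t p ]

module _ {E : Set} where

  -- alternating: swapping two (distinct) positions negates the value
  -- (transpositions generate the symmetric group)
  Alternating : ∀ {r} → ((Fin r → E) → Sign) → Set
  Alternating {r} χ = ∀ (t : Fin r → E) (p q : Fin r) → p ≢ q → χ (swapT t p q) ≡ negS (χ t)

  Exchange : ∀ {r} → ((Fin r → E) → Sign) → Set
  Exchange {zero}  χ = Data.Unit.⊤ where import Data.Unit
  Exchange {suc r} χ =
    ∀ (i j : Fin (suc r) → E) →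
      (∀ (s : Fin (suc r)) → NonNegS (χ (i [ zero ≔ j s ]) ·S χ (j [ s ≔ i zero ]))) →
      NonNegS (χ i ·S χ j)

  record IsChirotope {r} (χ : (Fin r → E) → Sign) : Set where
    field
      nonzero     : ∃ λ t → χ t ≢ zer
      alternating : Alternating χ
      exchange    : Exchange χ

Realizable : (R : RealField) → ∀ {r m} → ((Fin r → Fin m) → Sign) → Set
Realizable R {r} {m} χ =
  Σ (Fin r → Fin m → RealField.Carrier R) λ V →
    ∀ (t : Fin r → Fin m) → χ t ≡ sgn R (det R (λ a b → V a (t b)))

-- P-matroids on [2n]  (i ↦ i ↑ˡ n,  ī ↦ n ↑ʳ i)

elem : ∀ {n} → Fin n → Bool → Fin (n + n)
elem {n} i false = i ↑ˡ n
elem {n} i true  = n ↑ʳ i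

basisT : ∀ {n} → (Fin n → Bool) → Fin n → Fin (n + n)
basisT B j = elem j (B j)

IsPMatroid : ∀ n → ((Fin n → Fin (n + n)) → Sign) → Set
IsPMatroid n χ =
  IsChirotope χ ×
  (∀ (B : Fin n → Bool) (i : Fin n) →
     (χ (basisT B [ i ≔ elem {n} i false ]) ≡ negS (χ (basisT B [ i ≔ elem {n} i true ]))) ×
     (χ (basisT B [ i ≔ elem {n} i false ]) ≢ zer))

emb : ∀ {n} → Fin (n + n) → Fin (suc (n + n))
emb = inject₁

last : ∀ n → Fin (suc (n + n))
last n = fromℕ (n + n)

restrict : ∀ {n} → ((Fin n → Fin (suc (n + n))) → Sign) → ((Fin n → Fin (n + n)) → Sign)
restrict {n} χ t = χ (λ k → emb {n} (t k))

hatT : ∀ {n} → (Fin n → Bool) → Fin n → Fin (suc (n + n))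
hatT {n} B j = emb {n} (basisT B j)

Nondegenerate : ∀ n → ((Fin n → Fin (suc (n + n))) → Sign) → Set
Nondegenerate n χ = ∀ (B : Fin n → Bool) (i : Fin n) → χ (hatT B [ i ≔ last n ]) ≢ zer

-- Orientations of the n-cube: O B i holds iff the edge {B, B ⊕ {i}}
-- is oriented from B to B ⊕ {i}.  Vertices B ⊆ [n] are Fin n → Bool.

CubeOrientation : ℕ → Set₁
CubeOrientation n = (Fin n → Bool) → Fin n → Set

POMCP-orientation : ∀ n → ((Fin n → Fin (suc (n + n))) → Sign) → CubeOrientation n
POMCP-orientation n χ B i = (χ (hatT B) ·S χ (hatT B [ i ≔ last n ])) ≡ minus

SameOrientation : ∀ {n} → CubeOrientation n → CubeOrientation n → Set
SameOrientation {n} O O' = ∀ (B : Fin n → Bool) (i : Fin n) → O B i ⇔ O' B i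

module _ (R : RealField) where
  open RealField R

  Matrix : ℕ → Set
  Matrix n = Fin n → Fin n → Carrier

  StrictlyIncreasing : ∀ {k n} → (Fin k → Fin n) → Set
  StrictlyIncreasing f = ∀ a b → a <ᶠ b → f a <ᶠ f b

  IsPMatrix : ∀ {n} → Matrix n → Set
  IsPMatrix {n} M = ∀ k (f : Fin k → Fin n) → StrictlyIncreasing f →
                    0ᴿ <ᴿ det R (λ a b → M (f a) (f b))

  δ : ∀ {n} → Fin n → Fin n → Carrier
  δ a c with a ≟ c
  ... | yes _ = 1ᴿ
  ... | no  _ = 0ᴿ

  A[_,_] : ∀ {n} → Matrix n → (Fin n → Bool) → Matrix n
  A[ M , B ] a c = if B c then -ᴿ M a c else δ a c

  A[_,_][_,_] : ∀ {n} → Matrix n → (Fin n → Bool) → Fin n → (Fin n → Carrier) → Matrix n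
  A[ M , B ][ i , q ] a c with c ≟ i
  ... | yes _ = q a
  ... | no  _ = A[ M , B ] a c

  NondegenerateQ : ∀ {n} → Matrix n → (Fin n → Carrier) → Set
  NondegenerateQ {n} M q = ∀ (B : Fin n → Bool) (i : Fin n) → det R (A[ M , B ][ i , q ]) ≢ 0ᴿ

  PLCP-orientationOf : ∀ {n} → Matrix n → (Fin n → Carrier) → CubeOrientation n
  PLCP-orientationOf M q B i = det R (A[ M , B ]) *ᴿ det R (A[ M , B ][ i , q ]) <ᴿ 0ᴿ

  IsPLCP-orientation : ∀ {n} → CubeOrientation n → Set
  IsPLCP-orientation {n} O =
    Σ (Matrix n) λ M → Σ (Fin n → Carrier) λ q →
      IsPMatrix M × NondegenerateQ M q × SameOrientation O (PLCP-orientationOf M q)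

-- Take a realization V of the oriented matroid, an n × (2n+1) real matrix. The P-matroid axiom makes
-- its first n columns W a basis, so Y = W⁻¹ V has the identity there; reading its remaining columns
-- as −M and q, every A_B and A_B[i,q] is a column selection of Y, whose determinant is det W⁻¹ times
-- the corresponding determinant of V. Hence the PLCP and POMCP orientations coincide, and q is
-- nondegenerate. The sign-alternation of the P-matroid gives sgn det A_B = (−1)^|B|, while det A_B
-- is (−1)^|B| times the principal minor of M on B, so M is a P-matrix.

module Submission where

open import Defs
open import Data.Nat using (ℕ; suc; _+_)
open import Data.Fin using (Fin)

open import Level using (0ℓ)
open import Algebra.Bundles using (CommutativeRing)
open import Algebra.Structures using (IsCommutativeRing)
import Algebra.Properties.CommutativeSemigroup as CommutativeSemigroupProperties
import Algebra.Properties.Ring as RingProperties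
open import Data.Bool using (Bool; true; false; if_then_else_)
open import Data.Empty using (⊥-elim)
open import Data.Fin as Fin using (zero; suc; punchIn; punchOut; toℕ; fromℕ<; inject₁; _≟_)
import Data.Fin.Properties as Finₚ
open import Data.Nat as ℕ using (zero; z≤n; s≤s)
import Data.Nat.Properties as ℕₚ
open import Data.Product using (∃; _×_; _,_; proj₁; proj₂)
open import Data.Sum using (inj₁; inj₂; [_,_]′)
open import Function using (_∘_; mk⇔)
open import Relation.Binary.Definitions using (tri<; tri≈; tri>)
open import Relation.Binary.PropositionalEquality
open import Relation.Binary.Structures using (IsStrictTotalOrder)
open import Relation.Nullary using (¬_; yes; no; Dec; does; ¬?)

module _ {r : ℕ} {E : Set} where

  [≔]-updated : ∀ (t : Fin r → E) p e → (t [ p ≔ e ]) p ≡ e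
  [≔]-updated t p e with p ≟ p
  ... | yes _  = refl
  ... | no p≢p = ⊥-elim (p≢p refl)

  [≔]-other : ∀ (t : Fin r → E) {p} e {k} → k ≢ p → (t [ p ≔ e ]) k ≡ t k
  [≔]-other t {p} e {k} k≢p with k ≟ p
  ... | yes k≡p = ⊥-elim (k≢p k≡p)
  ... | no _    = refl

  [≔]-cong : ∀ {u v : Fin r → E} → (∀ k → u k ≡ v k) → ∀ p e k → (u [ p ≔ e ]) k ≡ (v [ p ≔ e ]) k
  [≔]-cong u≗v p e k with k ≟ p
  ... | yes _ = refl
  ... | no  _ = u≗v k

  [≔]-idem : ∀ (t : Fin r → E) p e e' k → ((t [ p ≔ e ]) [ p ≔ e' ]) k ≡ (t [ p ≔ e' ]) k
  [≔]-idem t p e e' k with k ≟ p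
  ... | yes _   = refl
  ... | no  k≢p = [≔]-other t e k≢p

  [≔]-self : ∀ (t : Fin r → E) p k → (t [ p ≔ t p ]) k ≡ t k
  [≔]-self t p k with k ≟ p
  ... | yes refl = refl
  ... | no  _    = refl

  [≔]-comm : ∀ (t : Fin r → E) {p q} → p ≢ q → ∀ e e' k →
             ((t [ p ≔ e ]) [ q ≔ e' ]) k ≡ ((t [ q ≔ e' ]) [ p ≔ e ]) k
  [≔]-comm t {p} {q} p≢q e e' k = by-cases (k ≟ p) (k ≟ q)
    where
    by-cases : Dec (k ≡ p) → Dec (k ≡ q) → ((t [ p ≔ e ]) [ q ≔ e' ]) k ≡ ((t [ q ≔ e' ]) [ p ≔ e ]) k
    by-cases (yes refl) (yes refl) = ⊥-elim (p≢q refl)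
    by-cases (yes refl) (no k≢q)   = trans ([≔]-other _ e' k≢q) (trans ([≔]-updated t k e) (sym ([≔]-updated _ k e)))
    by-cases (no k≢p)   (yes refl) = trans ([≔]-updated _ k e') (sym (trans ([≔]-other _ e k≢p) ([≔]-updated t k e')))
    by-cases (no k≢p)   (no k≢q)   = trans ([≔]-other _ e' k≢q) (trans ([≔]-other t e k≢p)
                                       (sym (trans ([≔]-other _ e k≢p) ([≔]-other t e' k≢q))))

  swapT-first : ∀ (t : Fin r → E) {p q} → p ≢ q → swapT t p q p ≡ t q
  swapT-first t {p} p≢q = trans ([≔]-other _ _ p≢q) ([≔]-updated t p _)

  swapT-other : ∀ (t : Fin r → E) {p q k} → k ≢ p → k ≢ q → swapT t p q k ≡ t k
  swapT-other t k≢p k≢q = trans ([≔]-other _ _ k≢q) ([≔]-other t _ k≢p)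

module _ {r : ℕ} {E F : Set} (g : E → F) where

  [≔]-map : ∀ (t : Fin r → E) p e k →
            g ((t [ p ≔ e ]) k) ≡ ((g ∘ t) [ p ≔ g e ]) k
  [≔]-map t p e k with k ≟ p
  ... | yes _ = refl
  ... | no  _ = refl

  swapT-map : ∀ (t : Fin r → E) p q k →
              g (swapT t p q k) ≡ swapT (g ∘ t) p q k
  swapT-map t p q k = trans ([≔]-map _ q (t p) k)
                              ([≔]-cong (λ k → [≔]-map t p (t q) k) q (g (t p)) k)


Adjacent : ∀ {n} → Fin n → Fin n → Set
Adjacent p q = toℕ q ≡ suc (toℕ p)

Adjacent⇒≢ : ∀ {n} {p q : Fin n} → Adjacent p q → p ≢ q
Adjacent⇒≢ p~q refl = ℕₚ.1+n≢n (sym p~q)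

punchIn-adjacent : ∀ {n} {X : Set} {p q : Fin (suc n)} → Adjacent p q →
                   (g : Fin (suc n) → X) → g p ≡ g q → ∀ b → g (punchIn p b) ≡ g (punchIn q b)
punchIn-adjacent {p = zero}  {suc zero}    p~q g gp≡gq zero    = sym gp≡gq
punchIn-adjacent {p = zero}  {suc zero}    p~q g gp≡gq (suc b) = refl
punchIn-adjacent {p = suc p} {suc q}       p~q g gp≡gq zero    = refl
punchIn-adjacent {p = suc p} {suc q}       p~q g gp≡gq (suc b) =
  punchIn-adjacent {p = p} {q} (ℕₚ.suc-injective p~q) (g ∘ suc) gp≡gq b

punchOut-adjacent : ∀ {n} {j p q : Fin (suc n)} (j≢p : j ≢ p) (j≢q : j ≢ q) →
                    Adjacent p q → Adjacent (punchOut j≢p) (punchOut j≢q)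
punchOut-adjacent {j = zero}  {zero}  j≢p j≢q p~q = ⊥-elim (j≢p refl)
punchOut-adjacent {j = zero}  {suc p} {suc q} j≢p j≢q p~q = ℕₚ.suc-injective p~q
punchOut-adjacent {suc n} {j = suc zero}     {zero} {suc zero} j≢p j≢q p~q = ⊥-elim (j≢q refl)
punchOut-adjacent {suc (suc n)} {j = suc (suc j)} {zero} {suc zero} j≢p j≢q p~q = refl
punchOut-adjacent {suc n} {j = suc j} {suc p} {suc q} j≢p j≢q p~q =
  cong suc (punchOut-adjacent {j = j} {p} {q} (j≢p ∘ cong suc) (j≢q ∘ cong suc) (ℕₚ.suc-injective p~q))

m<n⇒n≡1+[n∸1+m]+m : ∀ {m n} → m ℕ.< n → n ≡ suc (n ℕ.∸ suc m + m)
m<n⇒n≡1+[n∸1+m]+m {m} m<n = sym (trans (sym (ℕₚ.+-suc _ m)) (ℕₚ.m∸n+n≡m m<n))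

missing⇒collision : ∀ {n} (f : Fin n → Fin n) kk → (∀ d → f d ≢ kk) → ∃ λ i → ∃ λ j → i ≢ j × f i ≡ f j
missing⇒collision {suc n} f kk kk∉image
  with Finₚ.pigeonhole (ℕₚ.n<1+n n) (λ d → punchOut {i = kk} {j = f d} (kk∉image d ∘ sym))
... | i , j , i<j , gi≡gj = i , j , Finₚ.<⇒≢ i<j , Finₚ.punchOut-injective (kk∉image i ∘ sym) (kk∉image j ∘ sym) gi≡gj

module Determinant (R : RealField) where
  open RealField R
  open IsCommutativeRing isCommutativeRing
    using (+-comm; +-identityˡ; +-identityʳ; -‿inverseʳ; *-assoc; *-comm;
           *-identityˡ; *-identityʳ; distribˡ; distribʳ; zeroˡ; zeroʳ)
  open ≡-Reasoning

  commutativeRing : CommutativeRing 0ℓ 0ℓ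
  commutativeRing = record { isCommutativeRing = isCommutativeRing }

  open CommutativeRing commutativeRing using (ring; +-commutativeSemigroup; *-commutativeSemigroup)
  open RingProperties ring using (-‿distribˡ-*; -‿distribʳ-*; -0#≈0#; x+x≈x⇒x≈0; +-inverseʳ-unique; -‿injective)
  open CommutativeSemigroupProperties +-commutativeSemigroup using (interchange)
  open CommutativeSemigroupProperties *-commutativeSemigroup using (x∙yz≈y∙xz)

  ∑ : ∀ {n} → (Fin n → Carrier) → Carrier
  ∑ = sumFin R

  ∑-cong : ∀ {n} {f g : Fin n → Carrier} → (∀ j → f j ≡ g j) → ∑ f ≡ ∑ g
  ∑-cong {zero}  f≗g = refl
  ∑-cong {suc n} f≗g = cong₂ _+ᴿ_ (f≗g zero) (∑-cong (f≗g ∘ suc))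

  ∑-+ : ∀ {n} (f g : Fin n → Carrier) → ∑ (λ j → f j +ᴿ g j) ≡ ∑ f +ᴿ ∑ g
  ∑-+ {zero}  f g = sym (+-identityˡ 0ᴿ)
  ∑-+ {suc n} f g = trans (cong (f zero +ᴿ g zero +ᴿ_) (∑-+ (f ∘ suc) (g ∘ suc)))
                          (interchange (f zero) (g zero) _ _)

  ∑-*ˡ : ∀ {n} x (f : Fin n → Carrier) → ∑ (λ j → x *ᴿ f j) ≡ x *ᴿ ∑ f
  ∑-*ˡ {zero}  x f = sym (zeroʳ x)
  ∑-*ˡ {suc n} x f = trans (cong (x *ᴿ f zero +ᴿ_) (∑-*ˡ x (f ∘ suc))) (sym (distribˡ x (f zero) _))

  ∑-zero : ∀ {n} (f : Fin n → Carrier) → (∀ j → f j ≡ 0ᴿ) → ∑ f ≡ 0ᴿ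
  ∑-zero {zero}  f f≗0 = refl
  ∑-zero {suc n} f f≗0 = trans (cong₂ _+ᴿ_ (f≗0 zero) (∑-zero (f ∘ suc) (f≗0 ∘ suc))) (+-identityˡ 0ᴿ)

  ∑-single : ∀ {n} (f : Fin n → Carrier) p → (∀ j → j ≢ p → f j ≡ 0ᴿ) → ∑ f ≡ f p
  ∑-single f zero f≗0 =
    trans (cong (f zero +ᴿ_) (∑-zero (f ∘ suc) (λ j → f≗0 (suc j) λ ()))) (+-identityʳ _)
  ∑-single f (suc p) f≗0 =
    trans (cong₂ _+ᴿ_ (f≗0 zero λ ()) (∑-single (f ∘ suc) p (λ j j≢p → f≗0 (suc j) (j≢p ∘ Finₚ.suc-injective))))
          (+-identityˡ _)

  ∑-pair : ∀ {n} (f : Fin n → Carrier) {p q} → p ≢ q → (∀ j → j ≢ p → j ≢ q → f j ≡ 0ᴿ) → ∑ f ≡ f p +ᴿ f q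
  ∑-pair f {zero}  {zero}  p≢q f≗0 = ⊥-elim (p≢q refl)
  ∑-pair f {zero}  {suc q} p≢q f≗0 =
    cong (f zero +ᴿ_) (∑-single (f ∘ suc) q (λ j j≢q → f≗0 (suc j) (λ ()) (j≢q ∘ Finₚ.suc-injective)))
  ∑-pair f {suc p} {zero}  p≢q f≗0 =
    trans (cong (f zero +ᴿ_) (∑-single (f ∘ suc) p (λ j j≢p → f≗0 (suc j) (j≢p ∘ Finₚ.suc-injective) (λ ()))))
          (+-comm _ _)
  ∑-pair f {suc p} {suc q} p≢q f≗0 =
    trans (cong₂ _+ᴿ_ (f≗0 zero (λ ()) (λ ()))
                      (∑-pair (f ∘ suc) (p≢q ∘ cong suc)
                              (λ j j≢p j≢q → f≗0 (suc j) (j≢p ∘ Finₚ.suc-injective) (j≢q ∘ Finₚ.suc-injective))))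
          (+-identityˡ _)

  δ-diag : ∀ {n} (a : Fin n) → δ R a a ≡ 1ᴿ
  δ-diag a with a ≟ a
  ... | yes _  = refl
  ... | no a≢a = ⊥-elim (a≢a refl)

  δ-offdiag : ∀ {n} {a b : Fin n} → a ≢ b → δ R a b ≡ 0ᴿ
  δ-offdiag {a = a} {b} a≢b with a ≟ b
  ... | yes a≡b = ⊥-elim (a≢b a≡b)
  ... | no _    = refl

  δ-sym : ∀ {n} (a b : Fin n) → δ R a b ≡ δ R b a
  δ-sym a b = by-cases (a ≟ b)
    where
    by-cases : Dec (a ≡ b) → δ R a b ≡ δ R b a
    by-cases (yes refl) = refl
    by-cases (no a≢b)   = trans (δ-offdiag a≢b) (sym (δ-offdiag (a≢b ∘ sym)))

  δ-injective : ∀ {m n} (σ : Fin m → Fin n) → (∀ {a b} → σ a ≡ σ b → a ≡ b) →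
                ∀ a b → δ R (σ a) (σ b) ≡ δ R a b
  δ-injective σ σ-inj a b = by-cases (a ≟ b)
    where
    by-cases : Dec (a ≡ b) → δ R (σ a) (σ b) ≡ δ R a b
    by-cases (yes refl) = trans (δ-diag (σ a)) (sym (δ-diag a))
    by-cases (no a≢b)   = trans (δ-offdiag (a≢b ∘ σ-inj)) (sym (δ-offdiag a≢b))

  ∑-δʳ : ∀ {n} (f : Fin n → Carrier) k → ∑ (λ j → f j *ᴿ δ R j k) ≡ f k
  ∑-δʳ f k = begin
    ∑ (λ j → f j *ᴿ δ R j k) ≡⟨ ∑-single _ k (λ j j≢k → trans (cong (f j *ᴿ_) (δ-offdiag j≢k)) (zeroʳ _)) ⟩
    f k *ᴿ δ R k k           ≡⟨ cong (f k *ᴿ_) (δ-diag k) ⟩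
    f k *ᴿ 1ᴿ                ≡⟨ *-identityʳ _ ⟩
    f k                      ∎

  ∑-δˡ : ∀ {n} (f : Fin n → Carrier) k → ∑ (λ j → δ R k j *ᴿ f j) ≡ f k
  ∑-δˡ f k = trans (∑-cong (λ j → trans (*-comm _ _) (cong (f j *ᴿ_) (δ-sym k j)))) (∑-δʳ f k)

  Mat : ℕ → Set
  Mat = Matrix R

  Det : ∀ {n} → Mat n → Carrier
  Det = det R

  minor : ∀ {n} → Mat (suc n) → Fin (suc n) → Mat n
  minor A j a b = A (suc a) (punchIn j b)

  laplaceTerm : ∀ {n} → Mat (suc n) → Fin (suc n) → Carrier
  laplaceTerm A j = altSign R j *ᴿ A zero j *ᴿ Det (minor A j)

  updateColumn : ∀ {n} → Mat n → Fin n → (Fin n → Carrier) → Mat n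
  updateColumn A c v a = A a [ c ≔ v a ]

  unit : ∀ {n} → Fin n → Fin n → Carrier
  unit k a = δ R a k

  det-cong : ∀ {n} {A B : Mat n} → (∀ a b → A a b ≡ B a b) → Det A ≡ Det B
  det-cong {zero}  A≗B = refl
  det-cong {suc n} A≗B = ∑-cong λ j →
    cong₂ (λ u v → altSign R j *ᴿ u *ᴿ v) (A≗B zero j) (det-cong (λ a b → A≗B (suc a) (punchIn j b)))

  det-linear-column : ∀ {n} (A B D : Mat n) c x →
                      (∀ a b → b ≢ c → A a b ≡ B a b) → (∀ a b → b ≢ c → A a b ≡ D a b) →
                      (∀ a → A a c ≡ x *ᴿ B a c +ᴿ D a c) → Det A ≡ x *ᴿ Det B +ᴿ Det D
  det-linear-column {suc n} A B D c x A≗B A≗D Ac =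
    trans (∑-cong λ j → term-linear j (j ≟ c))
          (trans (∑-+ (λ j → x *ᴿ laplaceTerm B j) (laplaceTerm D)) (cong (_+ᴿ ∑ (laplaceTerm D)) (∑-*ˡ x (laplaceTerm B))))
    where
    rearrange : ∀ s y u v → s *ᴿ (x *ᴿ y) *ᴿ u +ᴿ v ≡ x *ᴿ (s *ᴿ y *ᴿ u) +ᴿ v
    rearrange s y u v = cong (_+ᴿ v) (trans (cong (_*ᴿ u) (x∙yz≈y∙xz s x y)) (*-assoc x (s *ᴿ y) u))
    term-linear : ∀ j → Dec (j ≡ c) → laplaceTerm A j ≡ x *ᴿ laplaceTerm B j +ᴿ laplaceTerm D j
    term-linear j (yes refl) = begin
      altSign R j *ᴿ A zero j *ᴿ Det (minor A j)
        ≡⟨ cong (λ y → altSign R j *ᴿ y *ᴿ Det (minor A j)) (Ac zero) ⟩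
      altSign R j *ᴿ (x *ᴿ B zero j +ᴿ D zero j) *ᴿ Det (minor A j)
        ≡⟨ trans (cong (_*ᴿ Det (minor A j)) (distribˡ _ _ _)) (distribʳ _ _ _) ⟩
      altSign R j *ᴿ (x *ᴿ B zero j) *ᴿ Det (minor A j) +ᴿ altSign R j *ᴿ D zero j *ᴿ Det (minor A j)
        ≡⟨ rearrange _ _ _ _ ⟩
      x *ᴿ (altSign R j *ᴿ B zero j *ᴿ Det (minor A j)) +ᴿ altSign R j *ᴿ D zero j *ᴿ Det (minor A j)
        ≡⟨ cong₂ (λ u v → x *ᴿ (altSign R j *ᴿ B zero j *ᴿ u) +ᴿ altSign R j *ᴿ D zero j *ᴿ v)
                 (det-cong (λ a b → A≗B (suc a) (punchIn j b) (Finₚ.punchInᵢ≢i j b)))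
                 (det-cong (λ a b → A≗D (suc a) (punchIn j b) (Finₚ.punchInᵢ≢i j b))) ⟩
      x *ᴿ laplaceTerm B j +ᴿ laplaceTerm D j ∎
    term-linear j (no j≢c) = begin
      altSign R j *ᴿ A zero j *ᴿ Det (minor A j)
        ≡⟨ cong (altSign R j *ᴿ A zero j *ᴿ_) minor-linear ⟩
      altSign R j *ᴿ A zero j *ᴿ (x *ᴿ Det (minor B j) +ᴿ Det (minor D j))
        ≡⟨ trans (distribˡ _ _ _) (cong (_+ᴿ altSign R j *ᴿ A zero j *ᴿ Det (minor D j))
                                        (x∙yz≈y∙xz (altSign R j *ᴿ A zero j) x (Det (minor B j)))) ⟩
      x *ᴿ (altSign R j *ᴿ A zero j *ᴿ Det (minor B j)) +ᴿ altSign R j *ᴿ A zero j *ᴿ Det (minor D j)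
        ≡⟨ cong₂ (λ u v → x *ᴿ (altSign R j *ᴿ u *ᴿ Det (minor B j)) +ᴿ altSign R j *ᴿ v *ᴿ Det (minor D j))
                 (A≗B zero j j≢c) (A≗D zero j j≢c) ⟩
      x *ᴿ laplaceTerm B j +ᴿ laplaceTerm D j ∎
      where
      c′ = punchOut j≢c
      punchIn-c′ : punchIn j c′ ≡ c
      punchIn-c′ = Finₚ.punchIn-punchOut j≢c
      off-c′ : ∀ {b} → b ≢ c′ → punchIn j b ≢ c
      off-c′ {b} b≢c′ eq = b≢c′ (Finₚ.punchIn-injective j b c′ (trans eq (sym punchIn-c′)))
      minor-linear : Det (minor A j) ≡ x *ᴿ Det (minor B j) +ᴿ Det (minor D j)
      minor-linear = det-linear-column (minor A j) (minor B j) (minor D j) c′ x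
        (λ a b b≢c′ → A≗B (suc a) (punchIn j b) (off-c′ b≢c′))
        (λ a b b≢c′ → A≗D (suc a) (punchIn j b) (off-c′ b≢c′))
        (λ a → subst (λ k → A (suc a) k ≡ x *ᴿ B (suc a) k +ᴿ D (suc a) k) (sym punchIn-c′) (Ac (suc a)))

  det-updateColumn-+ : ∀ {n} (A : Mat n) c (u v : Fin n → Carrier) →
                       Det (updateColumn A c (λ a → u a +ᴿ v a)) ≡
                       Det (updateColumn A c u) +ᴿ Det (updateColumn A c v)
  det-updateColumn-+ A c u v =
    trans (det-linear-column _ _ _ c 1ᴿ same-off-c same-off-c
             (λ a → begin
                (A a [ c ≔ u a +ᴿ v a ]) c                           ≡⟨ [≔]-updated (A a) c _ ⟩
                u a +ᴿ v a                                           ≡⟨ cong (_+ᴿ v a) (*-identityˡ (u a)) ⟨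
                1ᴿ *ᴿ u a +ᴿ v a                                     ≡⟨ cong₂ (λ y z → 1ᴿ *ᴿ y +ᴿ z)
                                                                                 ([≔]-updated (A a) c _) ([≔]-updated (A a) c _) ⟨
                1ᴿ *ᴿ (A a [ c ≔ u a ]) c +ᴿ (A a [ c ≔ v a ]) c     ∎))
          (cong (_+ᴿ _) (*-identityˡ _))
    where
    same-off-c : ∀ {w w′ : Fin _ → Carrier} a b → b ≢ c → updateColumn A c w a b ≡ updateColumn A c w′ a b
    same-off-c a b b≢c = trans ([≔]-other (A a) _ b≢c) (sym ([≔]-other (A a) _ b≢c))

  det-zero-column : ∀ {n} (A : Mat n) c → (∀ a → A a c ≡ 0ᴿ) → Det A ≡ 0ᴿ
  det-zero-column A c Ac≡0 = x+x≈x⇒x≈0 (Det A) (sym (begin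
    Det A                   ≡⟨ det-linear-column A A A c 1ᴿ (λ _ _ _ → refl) (λ _ _ _ → refl) column-c ⟩
    1ᴿ *ᴿ Det A +ᴿ Det A    ≡⟨ cong (_+ᴿ Det A) (*-identityˡ (Det A)) ⟩
    Det A +ᴿ Det A          ∎))
    where
    column-c : ∀ a → A a c ≡ 1ᴿ *ᴿ A a c +ᴿ A a c
    column-c a = begin
      A a c                    ≡⟨ Ac≡0 a ⟩
      0ᴿ                       ≡⟨ +-identityʳ 0ᴿ ⟨
      0ᴿ +ᴿ 0ᴿ                 ≡⟨ cong (_+ᴿ 0ᴿ) (*-identityˡ 0ᴿ) ⟨
      1ᴿ *ᴿ 0ᴿ +ᴿ 0ᴿ           ≡⟨ cong₂ (λ y z → 1ᴿ *ᴿ y +ᴿ z) (Ac≡0 a) (Ac≡0 a) ⟨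
      1ᴿ *ᴿ A a c +ᴿ A a c     ∎

  det-column-combination : ∀ {n} m (A : Mat n) c (x : Fin m → Carrier) (B : Fin m → Mat n) →
                           (∀ k a b → b ≢ c → A a b ≡ B k a b) →
                           (∀ a → A a c ≡ ∑ (λ k → x k *ᴿ B k a c)) →
                           Det A ≡ ∑ (λ k → x k *ᴿ Det (B k))
  det-column-combination zero    A c x B A≗B Ac = det-zero-column A c Ac
  det-column-combination (suc m) A c x B A≗B Ac =
    trans (det-linear-column A (B zero) A′ c (x zero) (A≗B zero)
             (λ a b b≢c → sym ([≔]-other (A a) _ b≢c))
             (λ a → trans (Ac a) (cong (x zero *ᴿ B zero a c +ᴿ_) (sym ([≔]-updated (A a) c _)))))
          (cong (x zero *ᴿ Det (B zero) +ᴿ_)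
            (det-column-combination m A′ c (x ∘ suc) (B ∘ suc)
              (λ k a b b≢c → trans ([≔]-other (A a) _ b≢c) (A≗B (suc k) a b b≢c))
              (λ a → [≔]-updated (A a) c _)))
    where
    A′ = updateColumn A c (λ a → ∑ (λ k → x (suc k) *ᴿ B (suc k) a c))

  det-expand-column : ∀ {n} (A : Mat n) c → Det A ≡ ∑ (λ k → A k c *ᴿ Det (updateColumn A c (unit k)))
  det-expand-column A c = det-column-combination _ A c (λ k → A k c) (λ k → updateColumn A c (unit k))
    (λ k a b b≢c → sym ([≔]-other (A a) _ b≢c))
    (λ a → sym (trans (∑-cong λ k → cong (A k c *ᴿ_) (trans ([≔]-updated (A a) c _) (δ-sym a k))) (∑-δʳ (λ k → A k c) a)))

  altSign-adjacent : ∀ {n} {p q : Fin n} → Adjacent p q → altSign R q ≡ -ᴿ altSign R p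
  altSign-adjacent {p = zero}  {suc zero} p~q = refl
  altSign-adjacent {p = suc p} {suc q}    p~q = cong -ᴿ_ (altSign-adjacent {p = p} {q} (ℕₚ.suc-injective p~q))

  -- Laplace expansion along the first row: the two terms at p and q cancel, all other minors
  -- again have two equal adjacent columns.
  det-adjacent-equal-columns : ∀ {n} (A : Mat n) {p q} → Adjacent p q → (∀ a → A a p ≡ A a q) → Det A ≡ 0ᴿ
  det-adjacent-equal-columns {suc n} A {p} {q} p~q Ap≡Aq =
    trans (∑-pair (laplaceTerm A) (Adjacent⇒≢ p~q) other-terms) terms-cancel
    where
    other-terms : ∀ j → j ≢ p → j ≢ q → laplaceTerm A j ≡ 0ᴿ
    other-terms j j≢p j≢q = trans (cong (altSign R j *ᴿ A zero j *ᴿ_) minor≡0) (zeroʳ _)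
      where
      minor≡0 : Det (minor A j) ≡ 0ᴿ
      minor≡0 = det-adjacent-equal-columns (minor A j) (punchOut-adjacent j≢p j≢q p~q) λ a →
        trans (cong (A (suc a)) (Finₚ.punchIn-punchOut j≢p))
              (trans (Ap≡Aq (suc a)) (sym (cong (A (suc a)) (Finₚ.punchIn-punchOut j≢q))))
    terms-cancel : laplaceTerm A p +ᴿ laplaceTerm A q ≡ 0ᴿ
    terms-cancel = begin
      laplaceTerm A p +ᴿ altSign R q *ᴿ A zero q *ᴿ Det (minor A q)
        ≡⟨ cong₂ (λ s y → laplaceTerm A p +ᴿ s *ᴿ y *ᴿ Det (minor A q)) (altSign-adjacent p~q) (sym (Ap≡Aq zero)) ⟩
      laplaceTerm A p +ᴿ (-ᴿ altSign R p) *ᴿ A zero p *ᴿ Det (minor A q)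
        ≡⟨ cong (λ m → laplaceTerm A p +ᴿ (-ᴿ altSign R p) *ᴿ A zero p *ᴿ m)
                (det-cong (λ a b → sym (punchIn-adjacent p~q (A (suc a)) (Ap≡Aq (suc a)) b))) ⟩
      laplaceTerm A p +ᴿ (-ᴿ altSign R p) *ᴿ A zero p *ᴿ Det (minor A p)
        ≡⟨ cong (λ y → laplaceTerm A p +ᴿ y *ᴿ Det (minor A p)) (sym (-‿distribˡ-* _ _)) ⟩
      laplaceTerm A p +ᴿ (-ᴿ (altSign R p *ᴿ A zero p)) *ᴿ Det (minor A p)
        ≡⟨ cong (laplaceTerm A p +ᴿ_) (sym (-‿distribˡ-* _ _)) ⟩
      laplaceTerm A p +ᴿ -ᴿ laplaceTerm A p
        ≡⟨ -‿inverseʳ _ ⟩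
      0ᴿ ∎

  swapColumns : ∀ {n} → Mat n → Fin n → Fin n → Mat n
  swapColumns A p q a = swapT (A a) p q

  -- Bilinearity in columns p, q expands 0 = det (u+w | u+w) into det (u|w) + det (w|u). Equal columns
  -- are only assumed to give 0 at p, q, so that this also serves to bootstrap from adjacent columns.
  det-swapColumns-if : ∀ {n} (A : Mat n) {p q} → p ≢ q →
                       (∀ (X : Mat n) → (∀ a → X a p ≡ X a q) → Det X ≡ 0ᴿ) →
                       Det (swapColumns A p q) ≡ -ᴿ Det A
  det-swapColumns-if {n} A {p} {q} p≢q equal⇒0 = +-inverseʳ-unique (Det A) _ (begin
    Det A +ᴿ Det (S w u)                               ≡⟨ cong₂ _+ᴿ_ S-u-w (+-identityʳ _) ⟨
    (0ᴿ +ᴿ Det (S u w)) +ᴿ (Det (S w u) +ᴿ 0ᴿ)         ≡⟨ cong₂ (λ x y → (x +ᴿ Det (S u w)) +ᴿ (Det (S w u) +ᴿ y))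
                                                              (S-equal u) (S-equal w) ⟨
    (Det (S u u) +ᴿ Det (S u w)) +ᴿ (Det (S w u) +ᴿ Det (S w w))
                                                       ≡⟨ cong₂ _+ᴿ_ (det-updateColumn-+ (updateColumn A p u) q u w)
                                                                      (det-updateColumn-+ (updateColumn A p w) q u w) ⟨
    Det (S u (u ⊕ w)) +ᴿ Det (S w (u ⊕ w))             ≡⟨ S-additive-p u w (u ⊕ w) ⟨
    Det (S (u ⊕ w) (u ⊕ w))                            ≡⟨ S-equal (u ⊕ w) ⟩
    0ᴿ                                                 ∎)
    where
    u w : Fin n → Carrier
    u a = A a p
    w a = A a q
    _⊕_ : (Fin n → Carrier) → (Fin n → Carrier) → (Fin n → Carrier)
    (x ⊕ y) a = x a +ᴿ y a
    S : (Fin n → Carrier) → (Fin n → Carrier) → Mat n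
    S x y = updateColumn (updateColumn A p x) q y
    S-equal : ∀ x → Det (S x x) ≡ 0ᴿ
    S-equal x = equal⇒0 (S x x) λ a →
      trans ([≔]-other _ _ p≢q) (trans ([≔]-updated (A a) p _) (sym ([≔]-updated _ q _)))
    S-u-w : 0ᴿ +ᴿ Det (S u w) ≡ Det A
    S-u-w = trans (+-identityˡ _) (det-cong λ a b → trans ([≔]-cong ([≔]-self (A a) p) q (w a) b) ([≔]-self (A a) q b))
    S-additive-p : ∀ x y z → Det (S (x ⊕ y) z) ≡ Det (S x z) +ᴿ Det (S y z)
    S-additive-p x y z = begin
      Det (S (x ⊕ y) z)                                                   ≡⟨ det-cong (λ a → [≔]-comm (A a) p≢q _ _) ⟩
      Det (updateColumn (updateColumn A q z) p (x ⊕ y))                   ≡⟨ det-updateColumn-+ (updateColumn A q z) p x y ⟩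
      Det (updateColumn (updateColumn A q z) p x) +ᴿ
        Det (updateColumn (updateColumn A q z) p y)                       ≡⟨ cong₂ _+ᴿ_ (det-cong (λ a → sym ∘ [≔]-comm (A a) p≢q _ _))
                                                                                      (det-cong (λ a → sym ∘ [≔]-comm (A a) p≢q _ _)) ⟩
      Det (S x z) +ᴿ Det (S y z)                                          ∎

  det-equal-columns-at-distance : ∀ d {n} (A : Mat n) p q → toℕ q ≡ suc (d + toℕ p) →
                                  (∀ a → A a p ≡ A a q) → Det A ≡ 0ᴿ
  det-equal-columns-at-distance zero    A p q q≡ Ap≡Aq = det-adjacent-equal-columns A q≡ Ap≡Aq
  det-equal-columns-at-distance (suc d) A p (suc q₀) q≡ Ap≡Aq = -‿injective (begin
    -ᴿ Det A                ≡⟨ det-swapColumns-if A (Adjacent⇒≢ q′~q) (λ X → det-adjacent-equal-columns X q′~q) ⟨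
    Det (swapColumns A q′ q) ≡⟨ det-equal-columns-at-distance d (swapColumns A q′ q) p q′ q′≡ A′p≡A′q′ ⟩
    0ᴿ                       ≡⟨ -0#≈0# ⟨
    -ᴿ 0ᴿ                    ∎)
    where
    q = suc q₀
    q′ = inject₁ q₀
    q′~q : Adjacent q′ q
    q′~q = cong suc (sym (Finₚ.toℕ-inject₁ q₀))
    q′≡ : toℕ q′ ≡ suc (d + toℕ p)
    q′≡ = trans (Finₚ.toℕ-inject₁ q₀) (ℕₚ.suc-injective q≡)
    A′p≡A′q′ : ∀ a → swapColumns A q′ q a p ≡ swapColumns A q′ q a q′
    A′p≡A′q′ a = begin
      swapT (A a) q′ q p  ≡⟨ swapT-other (A a) (λ p≡q′ → ℕₚ.m≢1+n+m (toℕ p) (trans (cong toℕ p≡q′) q′≡))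
                                               (λ p≡q → ℕₚ.m≢1+n+m (toℕ p) (trans (cong toℕ p≡q) q≡)) ⟩
      A a p               ≡⟨ Ap≡Aq a ⟩
      A a q               ≡⟨ swapT-first (A a) (Adjacent⇒≢ q′~q) ⟨
      swapT (A a) q′ q q′ ∎

  det-equal-columns : ∀ {n} (A : Mat n) {p q} → p ≢ q → (∀ a → A a p ≡ A a q) → Det A ≡ 0ᴿ
  det-equal-columns A {p} {q} p≢q Ap≡Aq with ℕₚ.<-cmp (toℕ p) (toℕ q)
  ... | tri< p<q _ _ = det-equal-columns-at-distance _ A p q (m<n⇒n≡1+[n∸1+m]+m p<q) Ap≡Aq
  ... | tri≈ _ p≡q _ = ⊥-elim (p≢q (Finₚ.toℕ-injective p≡q))
  ... | tri> _ _ q<p = det-equal-columns-at-distance _ A q p (m<n⇒n≡1+[n∸1+m]+m q<p) (sym ∘ Ap≡Aq)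

  det-swapColumns : ∀ {n} (A : Mat n) {p q} → p ≢ q → Det (swapColumns A p q) ≡ -ᴿ Det A
  det-swapColumns A p≢q = det-swapColumns-if A p≢q (λ X → det-equal-columns X p≢q)

  det-δ : ∀ {n} → Det (δ R {n}) ≡ 1ᴿ
  det-δ {zero}  = refl
  det-δ {suc n} = trans (∑-single (laplaceTerm I) zero other-terms) (begin
    1ᴿ *ᴿ I zero zero *ᴿ Det (minor I zero)  ≡⟨ cong₂ (λ x y → 1ᴿ *ᴿ x *ᴿ y) (δ-diag {suc n} zero)
                                                       (det-cong {n} (δ-injective suc Finₚ.suc-injective)) ⟩
    1ᴿ *ᴿ 1ᴿ *ᴿ Det (δ R {n})                 ≡⟨ cong (1ᴿ *ᴿ 1ᴿ *ᴿ_) (det-δ {n}) ⟩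
    1ᴿ *ᴿ 1ᴿ *ᴿ 1ᴿ                            ≡⟨ trans (*-identityʳ _) (*-identityʳ _) ⟩
    1ᴿ                                       ∎)
    where
    I = δ R {suc n}
    other-terms : ∀ j → j ≢ zero → laplaceTerm I j ≡ 0ᴿ
    other-terms j j≢0 = trans (cong (λ x → altSign R j *ᴿ x *ᴿ Det (minor I j)) (δ-offdiag (j≢0 ∘ sym)))
                              (trans (cong (_*ᴿ Det (minor I j)) (zeroʳ _)) (zeroˡ _))

  reindexColumns : ∀ {n} → Mat n → (Fin n → Fin n) → Mat n
  reindexColumns W f a c = W a (f c)

  ReindexFormula : ∀ {n} → (Fin n → Fin n) → Set
  ReindexFormula f = ∀ W → Det (reindexColumns W f) ≡ Det (reindexColumns (δ R) f) *ᴿ Det W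

  reindexFormula-not-injective : ∀ {n} (f : Fin n → Fin n) {i j} → i ≢ j → f i ≡ f j → ReindexFormula f
  reindexFormula-not-injective f i≢j fi≡fj W = begin
    Det (reindexColumns W f)                        ≡⟨ det-equal-columns _ i≢j (λ a → cong (W a) fi≡fj) ⟩
    0ᴿ                                              ≡⟨ zeroˡ _ ⟨
    0ᴿ *ᴿ Det W                                     ≡⟨ cong (_*ᴿ Det W) (det-equal-columns _ i≢j (λ a → cong (δ R a) fi≡fj)) ⟨
    Det (reindexColumns (δ R) f) *ᴿ Det W            ∎

  reindexFormula-swap : ∀ {n} (f : Fin n → Fin n) {p q} → p ≢ q →
                        ReindexFormula (swapT f p q) → ReindexFormula f
  reindexFormula-swap f {p} {q} p≢q formula W = -‿injective (begin
    -ᴿ Det (reindexColumns W f)                    ≡⟨ swapped W ⟨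
    Det (reindexColumns W (swapT f p q))            ≡⟨ formula W ⟩
    Det (reindexColumns (δ R) (swapT f p q)) *ᴿ Det W ≡⟨ cong (_*ᴿ Det W) (swapped (δ R)) ⟩
    -ᴿ Det (reindexColumns (δ R) f) *ᴿ Det W        ≡⟨ -‿distribˡ-* _ _ ⟨
    -ᴿ (Det (reindexColumns (δ R) f) *ᴿ Det W)      ∎)
    where
    swapped : ∀ X → Det (reindexColumns X (swapT f p q)) ≡ -ᴿ Det (reindexColumns X f)
    swapped X = trans (det-cong (λ a → swapT-map (X a) f p q)) (det-swapColumns (reindexColumns X f) p≢q)

  FixesBelow : ∀ {n} → ℕ → (Fin n → Fin n) → Set
  FixesBelow k f = ∀ c → toℕ c ℕ.< k → f c ≡ c

  reindexFormula-fixesAll : ∀ {n} (f : Fin n → Fin n) → FixesBelow n f → ReindexFormula f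
  reindexFormula-fixesAll {n} f fixes W = begin
    Det (reindexColumns W f)               ≡⟨ det-cong (λ a c → cong (W a) (f≗id c)) ⟩
    Det W                                  ≡⟨ *-identityˡ _ ⟨
    1ᴿ *ᴿ Det W                            ≡⟨ cong (_*ᴿ Det W) (trans (det-cong (λ a c → cong (δ R a) (f≗id c))) (det-δ {n})) ⟨
    Det (reindexColumns (δ R) f) *ᴿ Det W  ∎
    where
    f≗id : ∀ c → f c ≡ c
    f≗id c = fixes c (Finₚ.toℕ<n c)

  -- If kk is not a value of f, two columns coincide; otherwise a column swap moves its preimage to kk.
  reindexFormula-extend : ∀ {n k} (kk : Fin n) → toℕ kk ≡ k →
                          (∀ f → FixesBelow (suc k) f → ReindexFormula f) →
                          ∀ f → FixesBelow k f → ReindexFormula f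
  reindexFormula-extend kk refl formula f fixes with Finₚ.any? (λ d → f d ≟ kk)
  ... | no kk∉image = let i , j , i≢j , fi≡fj = missing⇒collision f kk (λ d fd≡kk → kk∉image (d , fd≡kk))
                      in reindexFormula-not-injective f i≢j fi≡fj
  ... | yes (d , fd≡kk) with d ≟ kk
  ...   | yes refl = formula f λ c c<1+k → [ fixes c , (λ c≡kk → subst (λ x → f x ≡ x) (sym (Finₚ.toℕ-injective c≡kk)) fd≡kk) ]′
                                                 (ℕₚ.m<1+n⇒m<n∨m≡n c<1+k)
  ...   | no d≢kk  = reindexFormula-swap f kk≢d (formula (swapT f kk d) fixes′)
    where
    kk≢d : kk ≢ d
    kk≢d = d≢kk ∘ sym
    fixes′ : FixesBelow (suc (toℕ kk)) (swapT f kk d)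
    fixes′ c c<1+k with ℕₚ.m<1+n⇒m<n∨m≡n c<1+k
    ... | inj₁ c<k  = trans (swapT-other f c≢kk c≢d) (fixes c c<k)
      where
      c≢kk : c ≢ kk
      c≢kk refl = ℕₚ.<-irrefl refl c<k
      c≢d : c ≢ d
      c≢d refl = c≢kk (trans (sym (fixes c c<k)) fd≡kk)
    ... | inj₂ c≡kk rewrite Finₚ.toℕ-injective c≡kk = trans (swapT-first f kk≢d) fd≡kk

  reindexFormula-from : ∀ {n} m k → k ℕ.+ m ≡ n → ∀ f → FixesBelow {n} k f → ReindexFormula f
  reindexFormula-from zero    k k+0≡n f = reindexFormula-fixesAll f ∘ subst (λ x → FixesBelow x f) (trans (sym (ℕₚ.+-identityʳ k)) k+0≡n)
  reindexFormula-from (suc m) k k+1+m≡n =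
    reindexFormula-extend (fromℕ< k<n) (Finₚ.toℕ-fromℕ< k<n)
      (reindexFormula-from m (suc k) (trans (sym (ℕₚ.+-suc k m)) k+1+m≡n))
    where
    k<n : k ℕ.< _
    k<n = subst (k ℕ.<_) k+1+m≡n (ℕₚ.m<m+n k ℕ.z<s)

  det-reindexColumns : ∀ {n} (W : Mat n) f → Det (reindexColumns W f) ≡ Det (reindexColumns (δ R) f) *ᴿ Det W
  det-reindexColumns W f = reindexFormula-from _ 0 refl f (λ c ()) W

  infixl 7 _*ᴹ_
  _*ᴹ_ : ∀ {n} → Mat n → Mat n → Mat n
  (W *ᴹ Y) a c = ∑ (λ k → W a k *ᴿ Y k c)

  Extensional : ∀ {n} → (Mat n → Carrier) → Set
  Extensional Φ = ∀ {A B} → (∀ a b → A a b ≡ B a b) → Φ A ≡ Φ B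

  ColumnExpandable : ∀ {n} → (Mat n → Carrier) → Set
  ColumnExpandable Φ = ∀ A c → Φ A ≡ ∑ (λ k → A k c *ᴿ Φ (updateColumn A c (unit k)))

  firstColumns : ∀ {n} → ℕ → Mat n → (Fin n → Fin n) → Mat n
  firstColumns m A g a c with toℕ c ℕ.<? m
  ... | yes _ = A a c
  ... | no  _ = unit (g c) a

  firstColumns-< : ∀ {n} {m} (A : Mat n) g a c → toℕ c ℕ.< m → firstColumns m A g a c ≡ A a c
  firstColumns-< {m = m} A g a c c<m with toℕ c ℕ.<? m
  ... | yes _   = refl
  ... | no  c≮m = ⊥-elim (c≮m c<m)

  firstColumns-≮ : ∀ {n} {m} (A : Mat n) g a c → ¬ toℕ c ℕ.< m → firstColumns m A g a c ≡ unit (g c) a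
  firstColumns-≮ {m = m} A g a c c≮m with toℕ c ℕ.<? m
  ... | yes c<m = ⊥-elim (c≮m c<m)
  ... | no  _   = refl

  firstColumns-updateColumn : ∀ {n m} (A : Mat n) g c → toℕ c ≡ m → ∀ k a b →
                              updateColumn (firstColumns (suc m) A g) c (unit k) a b ≡ firstColumns m A (g [ c ≔ k ]) a b
  firstColumns-updateColumn {m = m} A g c toℕc≡m k a b = by-cases (b ≟ c) (toℕ b ℕ.<? m)
    where
    M = firstColumns (suc m) A g
    by-cases : Dec (b ≡ c) → Dec (toℕ b ℕ.< m) → updateColumn M c (unit k) a b ≡ firstColumns m A (g [ c ≔ k ]) a b
    by-cases (yes refl) _ = trans ([≔]-updated (M a) b _)
                                  (sym (trans (firstColumns-≮ A _ a b (ℕₚ.<-irrefl toℕc≡m))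
                                              (cong (λ x → unit x a) ([≔]-updated g b k))))
    by-cases (no b≢c) (yes b<m) = trans ([≔]-other (M a) _ b≢c)
                                    (trans (firstColumns-< A g a b (ℕₚ.m<n⇒m<1+n b<m)) (sym (firstColumns-< A _ a b b<m)))
    by-cases (no b≢c) (no b≮m) = trans ([≔]-other (M a) _ b≢c)
                                   (trans (firstColumns-≮ A g a b b≮1+m)
                                          (sym (trans (firstColumns-≮ A _ a b b≮m) (cong (λ x → unit x a) ([≔]-other g k b≢c)))))
      where
      b≮1+m : ¬ toℕ b ℕ.< suc m
      b≮1+m b<1+m = [ b≮m , (λ b≡m → b≢c (Finₚ.toℕ-injective (trans b≡m (sym toℕc≡m)))) ]′ (ℕₚ.m<1+n⇒m<n∨m≡n b<1+m)

  -- Expanding along the columns one after the other reduces every matrix to matrices of unit columns.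
  columnExpandable-unique : ∀ {n} {Φ Ψ : Mat n → Carrier} → Extensional Φ → Extensional Ψ →
                            ColumnExpandable Φ → ColumnExpandable Ψ →
                            (∀ g → Φ (reindexColumns (δ R) g) ≡ Ψ (reindexColumns (δ R) g)) →
                            ∀ A → Φ A ≡ Ψ A
  columnExpandable-unique {n} {Φ} {Ψ} Φ-ext Ψ-ext Φ-exp Ψ-exp agree A =
    trans (Φ-ext (λ a c → sym (all-of-A a c))) (trans (agree-first n ℕₚ.≤-refl (λ c → c)) (Ψ-ext all-of-A))
    where
    all-of-A : ∀ a c → firstColumns n A (λ c → c) a c ≡ A a c
    all-of-A a c = firstColumns-< A _ a c (Finₚ.toℕ<n c)
    agree-first : ∀ m → m ℕ.≤ n → ∀ g → Φ (firstColumns m A g) ≡ Ψ (firstColumns m A g)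
    agree-first zero    _   g = trans (Φ-ext none-of-A) (trans (agree g) (Ψ-ext (λ a b → sym (none-of-A a b))))
      where
      none-of-A : ∀ a c → firstColumns 0 A g a c ≡ δ R a (g c)
      none-of-A a c = firstColumns-≮ {m = 0} A g a c λ ()
    agree-first (suc m) m<n g = begin
      Φ M                                                  ≡⟨ Φ-exp M c ⟩
      ∑ (λ k → M k c *ᴿ Φ (updateColumn M c (unit k)))     ≡⟨ ∑-cong (λ k → cong (M k c *ᴿ_) (begin
          Φ (updateColumn M c (unit k))                        ≡⟨ Φ-ext (updated k) ⟩
          Φ (firstColumns m A (g [ c ≔ k ]))                   ≡⟨ agree-first m (ℕₚ.<⇒≤ m<n) (g [ c ≔ k ]) ⟩
          Ψ (firstColumns m A (g [ c ≔ k ]))                   ≡⟨ Ψ-ext (updated k) ⟨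
          Ψ (updateColumn M c (unit k))                        ∎)) ⟩
      ∑ (λ k → M k c *ᴿ Ψ (updateColumn M c (unit k)))     ≡⟨ Ψ-exp M c ⟨
      Ψ M                                                  ∎
      where
      M = firstColumns (suc m) A g
      c = fromℕ< m<n
      updated = firstColumns-updateColumn A g c (Finₚ.toℕ-fromℕ< m<n)

  det-* : ∀ {n} (W Y : Mat n) → Det (W *ᴹ Y) ≡ Det W *ᴿ Det Y
  det-* {n} W Y = columnExpandable-unique {Φ = λ Y → Det (W *ᴹ Y)} {Ψ = λ Y → Det W *ᴿ Det Y}
    (λ Y≗Y′ → det-cong (λ a c → ∑-cong (λ k → cong (W a k *ᴿ_) (Y≗Y′ k c))))
    (λ Y≗Y′ → cong (Det W *ᴿ_) (det-cong Y≗Y′))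
    product-expandable scalar-expandable on-unit-columns Y
    where
    product-expandable : ColumnExpandable (λ Y → Det (W *ᴹ Y))
    product-expandable A c = det-column-combination n (W *ᴹ A) c (λ k → A k c) (λ k → W *ᴹ updateColumn A c (unit k))
      (λ k a b b≢c → ∑-cong (λ j → cong (W a j *ᴿ_) (sym ([≔]-other (A j) _ b≢c))))
      (λ a → begin
        ∑ (λ k → W a k *ᴿ A k c)                                              ≡⟨ ∑-cong (λ k → *-comm (W a k) (A k c)) ⟩
        ∑ (λ k → A k c *ᴿ W a k)                                              ≡⟨ ∑-cong (λ k → cong (A k c *ᴿ_) (sym (unit-column k a))) ⟩
        ∑ (λ k → A k c *ᴿ (W *ᴹ updateColumn A c (unit k)) a c)               ∎)
      where
      unit-column : ∀ k a → (W *ᴹ updateColumn A c (unit k)) a c ≡ W a k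
      unit-column k a = trans (∑-cong (λ j → cong (W a j *ᴿ_) ([≔]-updated (A j) c _))) (∑-δʳ (W a) k)
    scalar-expandable : ColumnExpandable (λ Y → Det W *ᴿ Det Y)
    scalar-expandable A c = begin
      Det W *ᴿ Det A                                                       ≡⟨ cong (Det W *ᴿ_) (det-expand-column A c) ⟩
      Det W *ᴿ ∑ (λ k → A k c *ᴿ Det (updateColumn A c (unit k)))          ≡⟨ ∑-*ˡ {n} (Det W) _ ⟨
      ∑ (λ k → Det W *ᴿ (A k c *ᴿ Det (updateColumn A c (unit k))))        ≡⟨ ∑-cong (λ k → x∙yz≈y∙xz (Det W) (A k c) _) ⟩
      ∑ (λ k → A k c *ᴿ (Det W *ᴿ Det (updateColumn A c (unit k))))        ∎
    on-unit-columns : ∀ g → Det (W *ᴹ reindexColumns (δ R) g) ≡ Det W *ᴿ Det (reindexColumns (δ R) g)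
    on-unit-columns g = begin
      Det (W *ᴹ reindexColumns (δ R) g)              ≡⟨ det-cong (λ a c → ∑-δʳ (W a) (g c)) ⟩
      Det (reindexColumns W g)                      ≡⟨ det-reindexColumns W g ⟩
      Det (reindexColumns (δ R) g) *ᴿ Det W          ≡⟨ *-comm _ _ ⟩
      Det W *ᴿ Det (reindexColumns (δ R) g)          ∎

  -1^_ : ℕ → Carrier
  -1^ zero  = 1ᴿ
  -1^ suc k = -ᴿ (-1^ k)

  det-negate : ∀ {k} (X : Mat k) → Det (λ a b → -ᴿ X a b) ≡ -1^ k *ᴿ Det X
  det-negate {zero}  X = sym (*-identityˡ 1ᴿ)
  det-negate {suc k} X = trans (∑-cong term-negate) (∑-*ˡ (-1^ suc k) (laplaceTerm X))
    where
    term-negate : ∀ j → laplaceTerm (λ a b → -ᴿ X a b) j ≡ -1^ suc k *ᴿ laplaceTerm X j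
    term-negate j = begin
      altSign R j *ᴿ (-ᴿ X zero j) *ᴿ Det (λ a b → -ᴿ X (suc a) (punchIn j b))
        ≡⟨ cong₂ _*ᴿ_ (sym (-‿distribʳ-* _ _)) (det-negate (minor X j)) ⟩
      -ᴿ (altSign R j *ᴿ X zero j) *ᴿ (-1^ k *ᴿ Det (minor X j))
        ≡⟨ sym (-‿distribˡ-* _ _) ⟩
      -ᴿ (altSign R j *ᴿ X zero j *ᴿ (-1^ k *ᴿ Det (minor X j)))
        ≡⟨ cong -ᴿ_ (x∙yz≈y∙xz _ (-1^ k) _) ⟩
      -ᴿ (-1^ k *ᴿ laplaceTerm X j)
        ≡⟨ -‿distribˡ-* _ _ ⟩
      -1^ suc k *ᴿ laplaceTerm X j ∎

  det-unit-first-column : ∀ {m} (X : Mat (suc m)) → (∀ a → X a zero ≡ unit zero a) →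
                          Det X ≡ Det (λ a b → X (suc a) (suc b))
  det-unit-first-column {m} X X0≡e0 = trans (∑-single (laplaceTerm X) zero other-terms) (begin
    1ᴿ *ᴿ X zero zero *ᴿ Det (minor X zero)  ≡⟨ cong (λ x → 1ᴿ *ᴿ x *ᴿ Det (minor X zero))
                                                     (trans (X0≡e0 zero) (δ-diag {suc m} zero)) ⟩
    1ᴿ *ᴿ 1ᴿ *ᴿ Det (minor X zero)          ≡⟨ trans (cong (_*ᴿ Det (minor X zero)) (*-identityˡ 1ᴿ)) (*-identityˡ _) ⟩
    Det (minor X zero)                      ∎)
    where
    other-terms : ∀ j → j ≢ zero → laplaceTerm X j ≡ 0ᴿ
    other-terms zero    j≢0 = ⊥-elim (j≢0 refl)
    other-terms (suc j) _   =
      trans (cong (altSign R (suc j) *ᴿ X zero (suc j) *ᴿ_)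
                  (minor≡0 j {X} λ a → trans (X0≡e0 (suc a)) (δ-offdiag {a = suc a} {zero} λ ())))
            (zeroʳ _)
      where
      minor≡0 : ∀ {m} (j : Fin m) {Y : Mat (suc m)} → (∀ a → Y (suc a) zero ≡ 0ᴿ) → Det (minor Y (suc j)) ≡ 0ᴿ
      minor≡0 {suc m} j {Y} = det-zero-column (minor Y (suc j)) zero

  det-conjugate : ∀ {n} (σ : Fin n → Fin n) → (∀ {a b} → σ a ≡ σ b → a ≡ b) → ∀ (X : Mat n) →
                  Det (λ a b → X (σ a) (σ b)) ≡ Det X
  det-conjugate {n} σ σ-inj X = begin
    Det (λ a b → X (σ a) (σ b))                        ≡⟨ det-cong (λ a b → sym (∑-δˡ (λ k → X k (σ b)) (σ a))) ⟩
    Det (reindexColumns (Pσ *ᴹ X) σ)                    ≡⟨ det-reindexColumns (Pσ *ᴹ X) σ ⟩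
    Det Qσ *ᴿ Det (Pσ *ᴹ X)                             ≡⟨ cong (Det Qσ *ᴿ_) (det-* Pσ X) ⟩
    Det Qσ *ᴿ (Det Pσ *ᴿ Det X)                         ≡⟨ *-assoc _ _ _ ⟨
    Det Qσ *ᴿ Det Pσ *ᴿ Det X                           ≡⟨ cong (_*ᴿ Det X) (*-comm _ _) ⟩
    Det Pσ *ᴿ Det Qσ *ᴿ Det X                           ≡⟨ cong (_*ᴿ Det X) (det-* Pσ Qσ) ⟨
    Det (Pσ *ᴹ Qσ) *ᴿ Det X                             ≡⟨ cong (_*ᴿ Det X) (trans (det-cong Pσ*Qσ≡I) (det-δ {n})) ⟩
    1ᴿ *ᴿ Det X                                        ≡⟨ *-identityˡ _ ⟩
    Det X                                              ∎
    where
    Pσ Qσ : Mat n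
    Pσ a k = δ R (σ a) k
    Qσ = reindexColumns (δ R) σ
    Pσ*Qσ≡I : ∀ a b → (Pσ *ᴹ Qσ) a b ≡ δ R a b
    Pσ*Qσ≡I a b = trans (∑-δˡ (λ k → δ R k (σ b)) (σ a)) (δ-injective σ σ-inj a b)

  moveToFront : ∀ {m} → Fin (suc m) → Fin (suc m) → Fin (suc m)
  moveToFront c zero    = c
  moveToFront c (suc b) = punchIn c b

  moveToFront-injective : ∀ {m} (c : Fin (suc m)) {a b} → moveToFront c a ≡ moveToFront c b → a ≡ b
  moveToFront-injective c {zero}  {zero}  _  = refl
  moveToFront-injective c {zero}  {suc b} eq = ⊥-elim (Finₚ.punchInᵢ≢i c b (sym eq))
  moveToFront-injective c {suc a} {zero}  eq = ⊥-elim (Finₚ.punchInᵢ≢i c a eq)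
  moveToFront-injective c {suc a} {suc b} eq = cong suc (Finₚ.punchIn-injective c a b eq)

  det-unit-column : ∀ {m} (X : Mat (suc m)) c → (∀ a → X a c ≡ unit c a) →
                    Det X ≡ Det (λ a b → X (punchIn c a) (punchIn c b))
  det-unit-column X c Xc≡ec = trans (sym (det-conjugate (moveToFront c) (moveToFront-injective c) X))
    (det-unit-first-column (λ a b → X (moveToFront c a) (moveToFront c b)) λ a →
       trans (Xc≡ec (moveToFront c a)) (δ-injective (moveToFront c) (moveToFront-injective c) a zero))

  increasing-injective : ∀ {k n} {f : Fin k → Fin n} → StrictlyIncreasing R f → ∀ {a b} → f a ≡ f b → a ≡ b
  increasing-injective {f = f} incr {a} {b} fa≡fb with Finₚ.<-cmp a b
  ... | tri< a<b _ _ = ⊥-elim (ℕₚ.<⇒≢ (incr a b a<b) (cong toℕ fa≡fb))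
  ... | tri≈ _ a≡b _ = a≡b
  ... | tri> _ _ b<a = ⊥-elim (ℕₚ.<⇒≢ (incr b a b<a) (cong toℕ (sym fa≡fb)))

  increasing⇒≤ : ∀ {k n} {f : Fin k → Fin n} → StrictlyIncreasing R f → ∀ a → toℕ a ℕ.≤ toℕ (f a)
  increasing⇒≤ {f = f} incr a = bound (toℕ a) a refl
    where
    bound : ∀ m a → toℕ a ≡ m → m ℕ.≤ toℕ (f a)
    bound zero    a        _  = z≤n
    bound (suc m) (suc a′) eq = ℕₚ.≤-trans
      (s≤s (bound m (inject₁ a′) (trans (Finₚ.toℕ-inject₁ a′) (ℕₚ.suc-injective eq))))
      (incr (inject₁ a′) (suc a′) (Finₚ.≤̄⇒inject₁< Finₚ.≤-refl))

  increasing-surjective⇒id : ∀ {n} {f : Fin n → Fin n} → StrictlyIncreasing R f → (∀ c → ∃ λ a → f a ≡ c) →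
                             ∀ a → f a ≡ a
  increasing-surjective⇒id {f = f} incr surj a =
    Finₚ.toℕ-injective (ℕₚ.≤-antisym
      (subst (λ x → toℕ (f a) ℕ.≤ toℕ x) (increasing-injective incr (proj₂ (surj (f a)))) (increasing⇒≤ g-incr (f a)))
      (increasing⇒≤ incr a))
    where
    g = proj₁ ∘ surj
    g-incr : StrictlyIncreasing R g
    g-incr c d c<d with Finₚ.<-cmp (g c) (g d)
    ... | tri< gc<gd _ _ = gc<gd
    ... | tri≈ _ gc≡gd _ = ⊥-elim (ℕₚ.<⇒≢ c<d (cong toℕ (trans (sym (proj₂ (surj c))) (trans (cong f gc≡gd) (proj₂ (surj d))))))
    ... | tri> _ _ gd<gc = ⊥-elim (ℕₚ.<-asym c<d (subst₂ Fin._<_ (proj₂ (surj d)) (proj₂ (surj c)) (incr (g d) (g c) gd<gc)))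

  det-surjective-minor : ∀ {k n} (f : Fin k → Fin n) → StrictlyIncreasing R f → (∀ c → ∃ λ a → f a ≡ c) →
                         ∀ (X : Mat n) → Det X ≡ Det (λ a b → X (f a) (f b))
  det-surjective-minor f incr surj X with Finₚ.cantor-schröder-bernstein (increasing-injective incr) preimage-injective
    where
    preimage-injective : ∀ {c d} → proj₁ (surj c) ≡ proj₁ (surj d) → c ≡ d
    preimage-injective {c} {d} eq = trans (sym (proj₂ (surj c))) (trans (cong f eq) (proj₂ (surj d)))
  ... | refl = det-cong λ a b → sym (cong₂ X (f≗id a) (f≗id b))
    where
    f≗id = increasing-surjective⇒id incr surj

  -- The unit columns off the image of f are removed one at a time by det-unit-column.
  det-principal-minor : ∀ {n} k (f : Fin k → Fin n) → StrictlyIncreasing R f → ∀ (X : Mat n) →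
                        (∀ c → (∀ a → f a ≢ c) → ∀ r → X r c ≡ unit c r) →
                        Det X ≡ Det (λ a b → X (f a) (f b))
  det-principal-minor k f incr X unit-off-f with Finₚ.any? (λ c → Finₚ.all? (λ a → ¬? (f a ≟ c)))
  ... | no all-hit = det-surjective-minor f incr preimage X
    where
    preimage : ∀ c → ∃ λ a → f a ≡ c
    preimage c with Finₚ.any? (λ a → f a ≟ c)
    ... | yes hit = hit
    ... | no  miss = ⊥-elim (all-hit (c , λ a fa≡c → miss (a , fa≡c)))
  det-principal-minor {suc m} k f incr X unit-off-f | yes (c , c∉image) =
    trans (det-unit-column X c (unit-off-f c c∉image))
          (trans (det-principal-minor k f′ incr′ X′ unit-off-f′)
                 (det-cong λ a b → cong₂ X (Finₚ.punchIn-punchOut (c≢f a)) (Finₚ.punchIn-punchOut (c≢f b))))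
    where
    c≢f : ∀ a → c ≢ f a
    c≢f a = c∉image a ∘ sym
    f′ : Fin k → Fin m
    f′ a = punchOut (c≢f a)
    incr′ : StrictlyIncreasing R f′
    incr′ a b a<b = Finₚ.≤∧≢⇒< (Finₚ.punchOut-mono-≤ (c≢f a) (c≢f b) (ℕₚ.<⇒≤ (incr a b a<b)))
                               (ℕₚ.<⇒≢ (incr a b a<b) ∘ cong toℕ ∘ Finₚ.punchOut-injective (c≢f a) (c≢f b))
    X′ : Mat m
    X′ a b = X (punchIn c a) (punchIn c b)
    unit-off-f′ : ∀ d → (∀ a → f′ a ≢ d) → ∀ r → X′ r d ≡ unit d r
    unit-off-f′ d d∉image r =
      trans (unit-off-f (punchIn c d) (λ a fa≡ → d∉image a (Finₚ.punchIn-injective c _ _ (trans (Finₚ.punchIn-punchOut (c≢f a)) fa≡)))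
                        (punchIn c r))
            (δ-injective (punchIn c) (Finₚ.punchIn-injective c _ _) r d)

  adjugate : ∀ {n} → Mat n → Mat n
  adjugate W j a = Det (updateColumn W j (unit a))

  adjugate-*-cancel : ∀ {n} (W : Mat n) j k → (adjugate W *ᴹ W) j k ≡ δ R j k *ᴿ Det W
  adjugate-*-cancel {n} W j k = begin
    ∑ (λ a → adjugate W j a *ᴿ W a k)   ≡⟨ ∑-cong {n} (λ a → *-comm _ _) ⟩
    ∑ (λ a → W a k *ᴿ adjugate W j a)   ≡⟨ ∑-cong (λ a → cong₂ _*ᴿ_ ([≔]-updated (W a) j _)
                                                                  (det-cong (λ b → [≔]-idem (W b) j _ _))) ⟨
    ∑ (λ a → X a j *ᴿ Det (updateColumn X j (unit a)))  ≡⟨ det-expand-column X j ⟨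
    Det X                               ≡⟨ by-cases (j ≟ k) ⟩
    δ R j k *ᴿ Det W                    ∎
    where
    X = updateColumn W j (λ a → W a k)
    by-cases : Dec (j ≡ k) → Det X ≡ δ R j k *ᴿ Det W
    by-cases (yes refl) = trans (det-cong (λ a → [≔]-self (W a) j)) (sym (trans (cong (_*ᴿ Det W) (δ-diag j)) (*-identityˡ _)))
    by-cases (no j≢k)   = trans (det-equal-columns X j≢k (λ a → trans ([≔]-updated (W a) j _) (sym ([≔]-other (W a) _ (j≢k ∘ sym)))))
                                (sym (trans (cong (_*ᴿ Det W) (δ-offdiag j≢k)) (zeroˡ _)))

  left-inverse : ∀ {n} (W : Mat n) → Det W ≢ 0ᴿ → ∃ λ P → ∀ j k → (P *ᴹ W) j k ≡ δ R j k
  left-inverse {n} W detW≢0 = P , P*W≡I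
    where
    d⁻¹ = proj₁ (inverse (Det W) detW≢0)
    P : Mat _
    P j a = d⁻¹ *ᴿ adjugate W j a
    P*W≡I : ∀ j k → (P *ᴹ W) j k ≡ δ R j k
    P*W≡I j k = begin
      ∑ (λ a → d⁻¹ *ᴿ adjugate W j a *ᴿ W a k)   ≡⟨ ∑-cong {n} (λ a → *-assoc _ _ _) ⟩
      ∑ (λ a → d⁻¹ *ᴿ (adjugate W j a *ᴿ W a k)) ≡⟨ ∑-*ˡ {n} d⁻¹ _ ⟩
      d⁻¹ *ᴿ (adjugate W *ᴹ W) j k               ≡⟨ cong (d⁻¹ *ᴿ_) (adjugate-*-cancel W j k) ⟩
      d⁻¹ *ᴿ (δ R j k *ᴿ Det W)                  ≡⟨ x∙yz≈y∙xz _ _ _ ⟩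
      δ R j k *ᴿ (d⁻¹ *ᴿ Det W)                  ≡⟨ cong (δ R j k *ᴿ_) (trans (*-comm _ _) (proj₂ (inverse (Det W) detW≢0))) ⟩
      δ R j k *ᴿ 1ᴿ                              ≡⟨ *-identityʳ _ ⟩
      δ R j k                                    ∎

  left-invertible⇒det≢0 : ∀ {n} (P W : Mat n) → (∀ j k → (P *ᴹ W) j k ≡ δ R j k) → Det P ≢ 0ᴿ
  left-invertible⇒det≢0 {n} P W P*W≡I detP≡0 = 0≢1 (begin
    0ᴿ                 ≡⟨ zeroˡ (Det W) ⟨
    0ᴿ *ᴿ Det W        ≡⟨ cong (_*ᴿ Det W) detP≡0 ⟨
    Det P *ᴿ Det W     ≡⟨ det-* P W ⟨
    Det (P *ᴹ W)       ≡⟨ det-cong P*W≡I ⟩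
    Det (δ R {n})      ≡⟨ det-δ {n} ⟩
    1ᴿ                 ∎)

  det≢0-if-inhabited : ∀ {n} (X : Mat n) → (Fin n → Det X ≢ 0ᴿ) → Det X ≢ 0ᴿ
  det≢0-if-inhabited {zero}  X _      = 0≢1 ∘ sym
  det≢0-if-inhabited {suc n} X det≢0 = det≢0 zero

negS-involutive : ∀ s → negS (negS s) ≡ s
negS-involutive plus  = refl
negS-involutive minus = refl
negS-involutive zer   = refl

·S-negSʳ : ∀ p s → p ·S negS s ≡ negS (p ·S s)
·S-negSʳ zer   s     = refl
·S-negSʳ plus  plus  = refl
·S-negSʳ plus  minus = refl
·S-negSʳ plus  zer   = refl
·S-negSʳ minus plus  = refl
·S-negSʳ minus minus = refl
·S-negSʳ minus zer   = refl

·S-≢zer : ∀ {p s} → p ≢ zer → s ≢ zer → p ·S s ≢ zer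
·S-≢zer {plus}  {plus}  _ _ ()
·S-≢zer {plus}  {minus} _ _ ()
·S-≢zer {minus} {plus}  _ _ ()
·S-≢zer {minus} {minus} _ _ ()
·S-≢zer {zer}           p≢0 _ = p≢0
·S-≢zer {plus}  {zer}   _ s≢0 = s≢0
·S-≢zer {minus} {zer}   _ s≢0 = s≢0

·S-cancel-square : ∀ {p} s t → p ≢ zer → (p ·S s) ·S (p ·S t) ≡ s ·S t
·S-cancel-square {zer}   s t p≢0 = ⊥-elim (p≢0 refl)
·S-cancel-square {plus}  s t _ = cong₂ _·S_ (plus-identity s) (plus-identity t)
  where
  plus-identity : ∀ s → plus ·S s ≡ s
  plus-identity plus  = refl
  plus-identity minus = refl
  plus-identity zer   = refl
·S-cancel-square {minus} plus  plus  _ = refl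
·S-cancel-square {minus} plus  minus _ = refl
·S-cancel-square {minus} plus  zer   _ = refl
·S-cancel-square {minus} minus plus  _ = refl
·S-cancel-square {minus} minus minus _ = refl
·S-cancel-square {minus} minus zer   _ = refl
·S-cancel-square {minus} zer   t     _ = refl

·S-fixes⇒plus : ∀ {p} s → p ≢ zer → p ≡ p ·S s → s ≡ plus
·S-fixes⇒plus {zer}   s     p≢0 _ = ⊥-elim (p≢0 refl)
·S-fixes⇒plus {plus}  plus  _ _ = refl
·S-fixes⇒plus {minus} plus  _ _ = refl
·S-fixes⇒plus {plus}  minus _ ()
·S-fixes⇒plus {plus}  zer   _ ()
·S-fixes⇒plus {minus} minus _ ()
·S-fixes⇒plus {minus} zer   _ ()

parity : ℕ → Sign
parity zero    = plus
parity (suc k) = negS (parity k)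

parity≢zer : ∀ k → parity k ≢ zer
parity≢zer zero    ()
parity≢zer (suc k) eq = parity≢zer k (trans (sym (negS-involutive (parity k))) (cong negS eq))

module RealSign (R : RealField) where
  open RealField R
  open IsCommutativeRing isCommutativeRing using (+-identityˡ; -‿inverseˡ; -‿inverseʳ; zeroˡ; zeroʳ; *-identityˡ)
  open CommutativeRing (Determinant.commutativeRing R) using (ring)
  open RingProperties ring using (-‿involutive; -‿distribˡ-*; -‿distribʳ-*; -0#≈0#)

  compare = IsStrictTotalOrder.compare isStrictTotalOrder

  sgn-pos : ∀ {x} → 0ᴿ <ᴿ x → sgn R x ≡ plus
  sgn-pos {x} 0<x with compare 0ᴿ x
  ... | tri< _ _ _   = refl
  ... | tri≈ ¬0<x _ _ = ⊥-elim (¬0<x 0<x)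
  ... | tri> ¬0<x _ _ = ⊥-elim (¬0<x 0<x)

  sgn-zer : ∀ {x} → x ≡ 0ᴿ → sgn R x ≡ zer
  sgn-zer {x} x≡0 with compare 0ᴿ x
  ... | tri< _ 0≢x _ = ⊥-elim (0≢x (sym x≡0))
  ... | tri≈ _ _ _   = refl
  ... | tri> _ 0≢x _ = ⊥-elim (0≢x (sym x≡0))

  sgn-neg : ∀ {x} → x <ᴿ 0ᴿ → sgn R x ≡ minus
  sgn-neg {x} x<0 with compare 0ᴿ x
  ... | tri< _ _ ¬x<0 = ⊥-elim (¬x<0 x<0)
  ... | tri≈ _ _ ¬x<0 = ⊥-elim (¬x<0 x<0)
  ... | tri> _ _ _    = refl

  data SignView (x : Carrier) : Sign → Set where
    positive : 0ᴿ <ᴿ x → SignView x plus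
    zero     : x ≡ 0ᴿ  → SignView x zer
    negative : x <ᴿ 0ᴿ → SignView x minus

  signView : ∀ x → SignView x (sgn R x)
  signView x with compare 0ᴿ x
  ... | tri< 0<x _ _ = positive 0<x
  ... | tri≈ _ 0≡x _ = zero (sym 0≡x)
  ... | tri> _ _ x<0 = negative x<0

  sgn≡minus⇒<0 : ∀ {x} → sgn R x ≡ minus → x <ᴿ 0ᴿ
  sgn≡minus⇒<0 {x} with sgn R x | signView x
  ... | minus | negative x<0 = λ _ → x<0

  sgn≡plus⇒0< : ∀ {x} → sgn R x ≡ plus → 0ᴿ <ᴿ x
  sgn≡plus⇒0< {x} with sgn R x | signView x
  ... | plus | positive 0<x = λ _ → 0<x

  ≢0⇒sgn≢zer : ∀ {x} → x ≢ 0ᴿ → sgn R x ≢ zer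
  ≢0⇒sgn≢zer {x} x≢0 with sgn R x | signView x
  ... | zer | zero x≡0 = λ _ → x≢0 x≡0

  <0⇒0<- : ∀ {x} → x <ᴿ 0ᴿ → 0ᴿ <ᴿ -ᴿ x
  <0⇒0<- {x} x<0 = subst₂ _<ᴿ_ (-‿inverseʳ x) (+-identityˡ (-ᴿ x)) (+-mono-< (-ᴿ x) x<0)

  0<-⇒<0 : ∀ {x} → 0ᴿ <ᴿ -ᴿ x → x <ᴿ 0ᴿ
  0<-⇒<0 {x} 0<-x = subst₂ _<ᴿ_ (+-identityˡ x) (-‿inverseˡ x) (+-mono-< x 0<-x)

  sgn-* : ∀ x y → sgn R (x *ᴿ y) ≡ sgn R x ·S sgn R y
  sgn-* x y with sgn R x | signView x | sgn R y | signView y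
  ... | zer   | zero x≡0     | _     | _            = sgn-zer (trans (cong (_*ᴿ y) x≡0) (zeroˡ y))
  ... | plus  | positive _   | zer   | zero y≡0     = sgn-zer (trans (cong (x *ᴿ_) y≡0) (zeroʳ x))
  ... | minus | negative _   | zer   | zero y≡0     = sgn-zer (trans (cong (x *ᴿ_) y≡0) (zeroʳ x))
  ... | plus  | positive 0<x | plus  | positive 0<y = sgn-pos (*-pos 0<x 0<y)
  ... | plus  | positive 0<x | minus | negative y<0 =
    sgn-neg (0<-⇒<0 (subst (0ᴿ <ᴿ_) (sym (-‿distribʳ-* x y)) (*-pos 0<x (<0⇒0<- y<0))))
  ... | minus | negative x<0 | plus  | positive 0<y =
    sgn-neg (0<-⇒<0 (subst (0ᴿ <ᴿ_) (sym (-‿distribˡ-* x y)) (*-pos (<0⇒0<- x<0) 0<y)))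
  ... | minus | negative x<0 | minus | negative y<0 =
    sgn-pos (subst (0ᴿ <ᴿ_) (trans (sym (-‿distribˡ-* x (-ᴿ y))) (trans (cong -ᴿ_ (sym (-‿distribʳ-* x y))) (-‿involutive _)))
                   (*-pos (<0⇒0<- x<0) (<0⇒0<- y<0)))

  sgn-negate : ∀ x → sgn R (-ᴿ x) ≡ negS (sgn R x)
  sgn-negate x with sgn R x | signView x
  ... | plus  | positive 0<x = sgn-neg (0<-⇒<0 (subst (0ᴿ <ᴿ_) (sym (-‿involutive x)) 0<x))
  ... | zer   | zero x≡0     = sgn-zer (trans (cong -ᴿ_ x≡0) -0#≈0#)
  ... | minus | negative x<0 = sgn-pos (<0⇒0<- x<0)

  0<1 : 0ᴿ <ᴿ 1ᴿ
  0<1 with compare 0ᴿ 1ᴿ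
  ... | tri< 0<1 _ _ = 0<1
  ... | tri≈ _ 0≡1 _ = ⊥-elim (0≢1 0≡1)
  ... | tri> _ _ 1<0 = ⊥-elim (IsStrictTotalOrder.asym isStrictTotalOrder 1<0
                                 (subst (0ᴿ <ᴿ_) square-of-neg (*-pos (<0⇒0<- 1<0) (<0⇒0<- 1<0))))
    where
    square-of-neg : -ᴿ 1ᴿ *ᴿ -ᴿ 1ᴿ ≡ 1ᴿ
    square-of-neg = trans (sym (-‿distribˡ-* 1ᴿ (-ᴿ 1ᴿ))) (trans (cong -ᴿ_ (*-identityˡ _)) (-‿involutive 1ᴿ))

  sgn-−1^ : ∀ k → sgn R (Determinant.-1^_ R k) ≡ parity k
  sgn-−1^ zero    = sgn-pos 0<1
  sgn-−1^ (suc k) = trans (sgn-negate _) (cong negS (sgn-−1^ k))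

module _ {n : ℕ} where

  image : ∀ {k} → (Fin k → Fin n) → Fin n → Bool
  image f c = does (Finₚ.any? (λ a → f a ≟ c))

  image-hit : ∀ {k} (f : Fin k → Fin n) a → image f (f a) ≡ true
  image-hit f a with Finₚ.any? (λ b → f b ≟ f a)
  ... | yes _ = refl
  ... | no  miss = ⊥-elim (miss (a , refl))

  image-miss : ∀ {k} (f : Fin k → Fin n) c → (∀ a → f a ≢ c) → image f c ≡ false
  image-miss f c c∉image with Finₚ.any? (λ a → f a ≟ c)
  ... | yes (a , fa≡c) = ⊥-elim (c∉image a fa≡c)
  ... | no  _          = refl

  image-suc : ∀ {k} (f : Fin (suc k) → Fin n) c → image f c ≡ (image (f ∘ suc) [ f zero ≔ true ]) c
  image-suc f c = by-cases (c ≟ f zero) (Finₚ.any? (λ a → f (suc a) ≟ c))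
    where
    hit : ∀ {k} (g : Fin k → Fin n) {a} → g a ≡ c → image g c ≡ true
    hit g {a} ga≡c = trans (cong (image g) (sym ga≡c)) (image-hit g a)
    by-cases : Dec (c ≡ f zero) → Dec (∃ λ a → f (suc a) ≡ c) → image f c ≡ (image (f ∘ suc) [ f zero ≔ true ]) c
    by-cases (yes c≡f0) _ = trans (hit f (sym c≡f0))
                                  (sym (trans (cong (image (f ∘ suc) [ f zero ≔ true ]) c≡f0) ([≔]-updated _ (f zero) true)))
    by-cases (no c≢f0) (yes (a , fa≡c)) = trans (hit f fa≡c) (sym (trans ([≔]-other _ true c≢f0) (hit (f ∘ suc) fa≡c)))
    by-cases (no c≢f0) (no miss) =
      trans (image-miss f c λ { zero f0≡c → c≢f0 (sym f0≡c) ; (suc a) fa≡c → miss (a , fa≡c) })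
            (sym (trans ([≔]-other _ true c≢f0) (image-miss (f ∘ suc) c λ a fa≡c → miss (a , fa≡c))))

module PLCPRealization (R : RealField) (n : ℕ) (χ : (Fin n → Fin (suc (n + n))) → Sign)
                       (realizable : Realizable R χ) (pMatroid : IsPMatroid n (restrict χ))
                       (nondegenerate : Nondegenerate n χ) where
  open RealField R
  open Determinant R
  open RingProperties (CommutativeRing.ring commutativeRing) using (-‿involutive)
  open RealSign R
  open ≡-Reasoning

  Element = Fin (suc (n + n))

  columnsAt : (Fin n → Element → Carrier) → (Fin n → Element) → Mat n
  columnsAt U t a b = U a (t b)

  V : Fin n → Element → Carrier
  V = proj₁ realizable

  χ≡sgn-det : ∀ t → χ t ≡ sgn R (Det (columnsAt V t))
  χ≡sgn-det = proj₂ realizable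

  χ-cong : ∀ {t t′} → (∀ k → t k ≡ t′ k) → χ t ≡ χ t′
  χ-cong t≗t′ = trans (χ≡sgn-det _) (trans (cong (sgn R) (det-cong λ a b → cong (V a) (t≗t′ b))) (sym (χ≡sgn-det _)))

  χ-hatT-[≔] : ∀ B i b → restrict χ (basisT B [ i ≔ elem i b ]) ≡ χ (hatT (B [ i ≔ b ]))
  χ-hatT-[≔] B i b = χ-cong λ k → cong (emb {n}) (basisT-[≔] k)
    where
    basisT-[≔] : ∀ k → (basisT B [ i ≔ elem i b ]) k ≡ basisT (B [ i ≔ b ]) k
    basisT-[≔] k with k ≟ i
    ... | yes refl = refl
    ... | no  _    = refl

  χ-flip : ∀ B i → χ (hatT (B [ i ≔ true ])) ≡ negS (χ (hatT (B [ i ≔ false ])))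
  χ-flip B i = begin
    χ (hatT (B [ i ≔ true ]))                            ≡⟨ negS-involutive _ ⟨
    negS (negS (χ (hatT (B [ i ≔ true ]))))              ≡⟨ cong (negS ∘ negS) (χ-hatT-[≔] B i true) ⟨
    negS (negS (restrict χ (basisT B [ i ≔ elem i true ]))) ≡⟨ cong negS (proj₁ (proj₂ pMatroid B i)) ⟨
    negS (restrict χ (basisT B [ i ≔ elem i false ]))    ≡⟨ cong negS (χ-hatT-[≔] B i false) ⟩
    negS (χ (hatT (B [ i ≔ false ])))                    ∎

  none : Fin n → Bool
  none _ = false

  W : Mat n
  W = columnsAt V (hatT none)

  det-W≢0 : Det W ≢ 0ᴿ
  det-W≢0 = det≢0-if-inhabited W λ i detW≡0 → proj₂ (proj₂ pMatroid none i) (begin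
    restrict χ (basisT none [ i ≔ elem i false ]) ≡⟨ χ-cong (λ k → cong (emb {n}) ([≔]-self (basisT none) i k)) ⟩
    χ (hatT none)                                 ≡⟨ χ≡sgn-det _ ⟩
    sgn R (Det W)                                 ≡⟨ sgn-zer detW≡0 ⟩
    zer                                           ∎)

  P : Mat n
  P = proj₁ (left-inverse W det-W≢0)

  P*W≡I : ∀ a c → (P *ᴹ W) a c ≡ δ R a c
  P*W≡I = proj₂ (left-inverse W det-W≢0)

  sP≢zer : sgn R (Det P) ≢ zer
  sP≢zer = ≢0⇒sgn≢zer (left-invertible⇒det≢0 P W P*W≡I)

  -- Y = P V realizes the same oriented matroid up to the sign of det P; its first n columns form the identity.
  Y : Fin n → Element → Carrier
  Y a e = ∑ (λ k → P a k *ᴿ V k e)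

  sgn-det-Y : ∀ t → sgn R (Det (columnsAt Y t)) ≡ sgn R (Det P) ·S χ t
  sgn-det-Y t = trans (cong (sgn R) (det-* P (columnsAt V t))) (trans (sgn-* _ _) (cong (sgn R (Det P) ·S_) (sym (χ≡sgn-det t))))

  M : Mat n
  M a c = -ᴿ Y a (emb {n} (n Fin.↑ʳ c))

  q : Fin n → Carrier
  q a = Y a (last n)

  A : (Fin n → Bool) → Mat n
  A = A[_,_] R M

  Aq : (Fin n → Bool) → Fin n → Mat n
  Aq B i = A[_,_][_,_] R M B i q

  A≡Y : ∀ B a c → A B a c ≡ Y a (hatT B c)
  A≡Y B a c with B c
  ... | true  = -‿involutive _
  ... | false = sym (P*W≡I a c)

  Aq≡Y : ∀ B i a c → Aq B i a c ≡ Y a ((hatT B [ i ≔ last n ]) c)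
  Aq≡Y B i a c with c ≟ i
  ... | yes _ = refl
  ... | no  _ = A≡Y B a c

  sgn-det-A : ∀ B → sgn R (Det (A B)) ≡ sgn R (Det P) ·S χ (hatT B)
  sgn-det-A B = trans (cong (sgn R) (det-cong (A≡Y B))) (sgn-det-Y (hatT B))

  sgn-det-Aq : ∀ B i → sgn R (Det (Aq B i)) ≡ sgn R (Det P) ·S χ (hatT B [ i ≔ last n ])
  sgn-det-Aq B i = trans (cong (sgn R) (det-cong (Aq≡Y B i))) (sgn-det-Y (hatT B [ i ≔ last n ]))

  sgn-det-A*det-Aq : ∀ B i → sgn R (Det (A B) *ᴿ Det (Aq B i)) ≡ χ (hatT B) ·S χ (hatT B [ i ≔ last n ])
  sgn-det-A*det-Aq B i = begin
    sgn R (Det (A B) *ᴿ Det (Aq B i))                                       ≡⟨ sgn-* _ _ ⟩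
    sgn R (Det (A B)) ·S sgn R (Det (Aq B i))                               ≡⟨ cong₂ _·S_ (sgn-det-A B) (sgn-det-Aq B i) ⟩
    (sgn R (Det P) ·S χ (hatT B)) ·S (sgn R (Det P) ·S χ (hatT B [ i ≔ last n ])) ≡⟨ ·S-cancel-square _ _ sP≢zer ⟩
    χ (hatT B) ·S χ (hatT B [ i ≔ last n ])                                 ∎

  sameOrientation : SameOrientation (POMCP-orientation n χ) (PLCP-orientationOf R M q)
  sameOrientation B i = mk⇔ (λ χχ≡- → sgn≡minus⇒<0 (trans (sgn-det-A*det-Aq B i) χχ≡-))
                            (λ det*det<0 → trans (sym (sgn-det-A*det-Aq B i)) (sgn-neg det*det<0))

  q-nondegenerate : NondegenerateQ R M q
  q-nondegenerate B i detAq≡0 =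
    ·S-≢zer sP≢zer (nondegenerate B i) (trans (sym (sgn-det-Aq B i)) (sgn-zer detAq≡0))

  sgn-det-A-flip : ∀ B i → sgn R (Det (A (B [ i ≔ true ]))) ≡ negS (sgn R (Det (A (B [ i ≔ false ]))))
  sgn-det-A-flip B i = begin
    sgn R (Det (A (B [ i ≔ true ])))                      ≡⟨ sgn-det-A _ ⟩
    sgn R (Det P) ·S χ (hatT (B [ i ≔ true ]))             ≡⟨ cong (sgn R (Det P) ·S_) (χ-flip B i) ⟩
    sgn R (Det P) ·S negS (χ (hatT (B [ i ≔ false ])))     ≡⟨ ·S-negSʳ (sgn R (Det P)) _ ⟩
    negS (sgn R (Det P) ·S χ (hatT (B [ i ≔ false ])))     ≡⟨ cong negS (sgn-det-A _) ⟨
    negS (sgn R (Det (A (B [ i ≔ false ]))))               ∎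

  A-cong : ∀ {B B′} → (∀ c → B c ≡ B′ c) → ∀ a c → A B a c ≡ A B′ a c
  A-cong B≗B′ a c = cong (λ b → if b then -ᴿ M a c else δ R a c) (B≗B′ c)

  -- Adding the elements of the image one at a time, each flips the sign.
  sgn-det-A-image : ∀ k (f : Fin k → Fin n) → StrictlyIncreasing R f → sgn R (Det (A (image f))) ≡ parity k
  sgn-det-A-image zero f _ = begin
    sgn R (Det (A (image f)))  ≡⟨ cong (sgn R) (det-cong (A-cong (λ c → image-miss f c λ ()))) ⟩
    sgn R (Det (δ R {n}))      ≡⟨ cong (sgn R) (det-δ {n}) ⟩
    sgn R 1ᴿ                   ≡⟨ sgn-pos 0<1 ⟩
    plus                       ∎
  sgn-det-A-image (suc k) f incr = begin
    sgn R (Det (A (image f)))                       ≡⟨ cong (sgn R) (det-cong (A-cong (image-suc f))) ⟩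
    sgn R (Det (A (image (f ∘ suc) [ f zero ≔ true ])))  ≡⟨ sgn-det-A-flip (image (f ∘ suc)) (f zero) ⟩
    negS (sgn R (Det (A (image (f ∘ suc) [ f zero ≔ false ]))))
                                                    ≡⟨ cong (negS ∘ sgn R) (det-cong (A-cong f0-already-missing)) ⟩
    negS (sgn R (Det (A (image (f ∘ suc)))))        ≡⟨ cong negS (sgn-det-A-image k (f ∘ suc) λ a b a<b → incr (suc a) (suc b) (s≤s a<b)) ⟩
    parity (suc k)                                  ∎
    where
    f0-already-missing : ∀ c → (image (f ∘ suc) [ f zero ≔ false ]) c ≡ image (f ∘ suc) c
    f0-already-missing c =
      subst (λ b → (image (f ∘ suc) [ f zero ≔ b ]) c ≡ image (f ∘ suc) c)
             (image-miss (f ∘ suc) (f zero) (λ a fa≡f0 → ℕₚ.<⇒≢ (incr zero (suc a) ℕ.z<s) (cong toℕ (sym fa≡f0))))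
             ([≔]-self (image (f ∘ suc)) (f zero) c)

  -- A_{image f} has unit columns off the image and -M on the image, so its principal minor is det (-M_ff).
  M-isPMatrix : IsPMatrix R M
  M-isPMatrix k f incr = sgn≡plus⇒0< (·S-fixes⇒plus _ (parity≢zer k) (begin
    parity k                                             ≡⟨ sgn-det-A-image k f incr ⟨
    sgn R (Det (A (image f)))                            ≡⟨ cong (sgn R) (det-principal-minor k f incr (A (image f)) unit-off-image) ⟩
    sgn R (Det (λ a b → A (image f) (f a) (f b)))        ≡⟨ cong (sgn R) (det-cong (λ a b → A-on-image a b)) ⟩
    sgn R (Det (λ a b → -ᴿ M (f a) (f b)))               ≡⟨ cong (sgn R) (det-negate (λ a b → M (f a) (f b))) ⟩
    sgn R (-1^ k *ᴿ Det (λ a b → M (f a) (f b)))         ≡⟨ sgn-* _ _ ⟩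
    sgn R (-1^ k) ·S sgn R (Det (λ a b → M (f a) (f b))) ≡⟨ cong (_·S sgn R (Det (λ a b → M (f a) (f b)))) (sgn-−1^ k) ⟩
    parity k ·S sgn R (Det (λ a b → M (f a) (f b)))      ∎))
    where
    unit-off-image : ∀ c → (∀ a → f a ≢ c) → ∀ r → A (image f) r c ≡ unit c r
    unit-off-image c c∉image r = cong (λ b → if b then -ᴿ M r c else δ R r c) (image-miss f c c∉image)
    A-on-image : ∀ a b → A (image f) (f a) (f b) ≡ -ᴿ M (f a) (f b)
    A-on-image a b = cong (λ x → if x then -ᴿ M (f a) (f b) else δ R (f a) (f b)) (image-hit f b)

  isPLCP-orientation : IsPLCP-orientation R (POMCP-orientation n χ)
  isPLCP-orientation = M , q , M-isPMatrix , q-nondegenerate , sameOrientation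

mainTheorem2 : (R : RealField) (n : ℕ) (χ : (Fin n → Fin (suc (n + n))) → Sign) →
               IsChirotope χ →
               Realizable R χ →
               IsPMatroid n (restrict χ) →
               Nondegenerate n χ →
               IsPLCP-orientation R (POMCP-orientation n χ)
mainTheorem2 R n χ _ realizable pMatroid nondegenerate =
  PLCPRealization.isPLCP-orientation R n χ realizable pMatroid nondegenerate
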